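{- Let $m$ be a positive integer and $k\in\{0,1,2,3\}$, and let $C_{m,k}(q)$ be the polynomial giving the number of ways to extend a $k$-clique to a $(k+1)$-clique in the distant graph of $\mathbb{P}(\mathrm{M}_m(q))$. Then for every integer $h$ with $0\le h\le m$, the coefficient of $q^{m^2-h}$ in $C_{m,k}(q)$ equals the coefficient of $q^h$ in the power series $\prod_{i=1}^\infty(1-q^i)^{k-1}$.
   Context: $\mathrm{M}_m(q)$ is the ring of $m\times m$ matrices over $\mathbb{F}_q$, $q$ a prime power. For a ring $R$ with identity, $\mathbb{P}(R)$ is the set of submodules $R(a,b)\subseteq R^2$ where $(a,b)$ is the first row of some matrix in $\mathrm{GL}_2(R)$; two such points $R(a,b)$, $R(c,d)$ are distant if $\begin{pmatrix}a&b\\c&d\end{pmatrix}\in\mathrm{GL}_2(R)$. A $k$-clique is a set of $k$ pairwise distant points; extending a $k$-clique means adding one point distant to all its points (for $k=0$ the number of extensions is the number of points). For $k\le3$ this number does not depend on the chosen $k$-clique and, as a function of the prime power $q$ (with $m$ fixed), equals a polynomial in $q$ with integer coefficients; explicitly $C_{m,0}(q)=\prod_{j=0}^{m-1}\frac{q^{2m-j}-1}{q^{j+1}-1}$, $C_{m,1}(q)=q^{m^2}$, $C_{m,2}(q)=\prod_{j=0}^{m-1}(q^m-q^j)$, $C_{m,3}(q)=(-1)^mq^{\frac{m(m-1)}{2}}\sum_{i=0}^m\prod_{j=0}^{m-i-1}(1-q^{m-j})$. -}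

module Defs where

open import Data.Nat as ℕ using (ℕ; zero; suc; _∸_; _≡ᵇ_)
open import Data.Nat.DivMod using (_/_)
open import Data.Bool using (if_then_else_)
open import Relation.Binary.PropositionalEquality using (_≡_)
open import Data.Integer using (ℤ; 0ℤ; 1ℤ; _+_; _*_; -_)

-- Formal power series over ℤ in one variable q, given by their coefficients.
-- Polynomials are power series with finite support.
Series : Set
Series = ℕ → ℤ

coeff : Series → ℕ → ℤ
coeff f n = f n

sumTo : (ℕ → ℤ) → ℕ → ℤ
sumTo f zero    = 0ℤ
sumTo f (suc n) = sumTo f n + f n

mono : ℕ → Series
mono d n = if d ≡ᵇ n then 1ℤ else 0ℤ

one : Series
one = mono 0

zeroS : Series
zeroS _ = 0ℤ

_⊕_ : Series → Series → Series
(f ⊕ g) n = f n + g n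

negS : Series → Series
negS f n = - f n

_⊖_ : Series → Series → Series
f ⊖ g = f ⊕ negS g

_⊛_ : Series → Series → Series
(f ⊛ g) n = sumTo (λ i → f i * g (n ∸ i)) (suc n)

infixl 7 _⊛_
infixl 6 _⊕_ _⊖_

prodS : (ℕ → Series) → ℕ → Series
prodS F zero    = one
prodS F (suc n) = prodS F n ⊛ F n

sumS : (ℕ → Series) → ℕ → Series
sumS F zero    = zeroS
sumS F (suc n) = sumS F n ⊕ F n

powS : Series → ℕ → Series
powS f zero    = one
powS f (suc e) = powS f e ⊛ f

signS : ℕ → Series
signS zero    = one
signS (suc m) = negS (signS m)

-- (1 - q^i)^{-1} = Σ_{t ≥ 0} q^{i t}   (for i ≥ 1; the coefficient of q^n only
-- involves t ≤ n)
geomS : ℕ → Series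
geomS i n = sumTo (λ t → mono (i ℕ.* t) n) (suc n)

-- (1 - q^i)^{k-1} for k ∈ ℕ (k = 0 gives exponent -1)
factorS : ℕ → ℕ → Series
factorS zero    i = geomS i
factorS (suc k) i = powS (one ⊖ mono i) k

-- coefficient of q^h in ∏_{i ≥ 1} (1 - q^i)^{k-1}; only the factors with
-- i ≤ h contribute to this coefficient (the others are 1 + O(q^{h+1})).
eulerCoeff : ℕ → ℕ → ℤ
eulerCoeff k h = prodS (λ j → factorS k (suc j)) h h

-- Numerator and denominator of C_{m,0}(q) = ∏_{j<m} (q^{2m-j}-1)/(q^{j+1}-1)
C0num : ℕ → Series
C0num m = prodS (λ j → mono ((2 ℕ.* m) ∸ j) ⊖ one) m

C0den : ℕ → Series
C0den m = prodS (λ j → mono (suc j) ⊖ one) m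

C1 : ℕ → Series
C1 m = mono (m ℕ.* m)

C2 : ℕ → Series
C2 m = prodS (λ j → mono m ⊖ mono j) m

C3 : ℕ → Series
C3 m = signS m ⊛ mono ((m ℕ.* (m ∸ 1)) / 2)
       ⊛ sumS (λ i → prodS (λ j → one ⊖ mono (m ∸ j)) (m ∸ i)) (suc m)

-- For k = 0, C_{m,0} is characterised
-- as the quotient: P · ∏(q^{j+1}-1) = ∏(q^{2m-j}-1) (the divisor has constant
-- term ±1, so this determines P uniquely in ℤ[[q]]).
IsC : ℕ → ℕ → Series → Set
IsC m zero                   P = ∀ n → (P ⊛ C0den m) n ≡ C0num m n
IsC m (suc zero)             P = ∀ n → P n ≡ C1 m n
IsC m (suc (suc zero))       P = ∀ n → P n ≡ C2 m n
IsC m (suc (suc (suc zero))) P = ∀ n → P n ≡ C3 m n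
IsC m (suc (suc (suc (suc k)))) P = ∀ n → P n ≡ zeroS n

module Submission where

-- Write (a;q)_n = (1 - a)(1 - aq) ⋯ (1 - aq^(n-1)).  Each C_{m,k} has degree m², so its
-- coefficient of q^(m²-h) is the coefficient of q^h in the reciprocal q^(m²) C_{m,k}(1/q), and for
-- h ≤ m only this reciprocal modulo q^(m+1) matters; modulo q^(m+1) the product ∏_{i≥1} (1 - q^i)
-- may be replaced by (q;q)_m.  The reciprocal is 1 for k = 1 and (q;q)_m for k = 2.  For k = 0,
-- C_{m,0} is the Gaussian binomial [2m choose m], and its reciprocal R satisfies
-- R (q;q)_m = (q^(m+1);q)_m ≡ 1.  For k = 3 the reciprocal is Σ_i (-1)^i q^(i(i+1)/2) (q^(i+1);q)_(m-i);
-- multiplying the q-binomial theorem (q;q)_m = Σ_i (-1)^i q^(i(i+1)/2) [m choose i] by (q;q)_m gives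
-- these summands times (q^(m-i+1);q)_i ≡ 1, so the reciprocal is ≡ (q;q)_m².

open import Defs
open import Data.Nat using (ℕ; zero; suc; _+_; _*_; _∸_; _≤_; _<_; z≤n; s≤s; _≤?_; _<?_; _≟_)
import Data.Nat.Properties as ℕₚ
open import Data.Nat.DivMod using (_/_; m*n/n≡m)
open import Data.Nat.Tactic.RingSolver using (solve-∀)
open import Data.Integer as ℤ using (ℤ; 0ℤ; 1ℤ)
import Data.Integer.Properties as ℤₚ
open import Algebra.Bundles using (AbelianGroup; CommutativeRing)
open import Algebra.Properties.CommutativeSemigroup ℤₚ.+-commutativeSemigroup
  using () renaming (interchange to ℤ-+-interchange)
open import Algebra.Properties.CommutativeSemigroup ℕₚ.+-commutativeSemigroup
  using () renaming (interchange to ℕ-+-interchange)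
open import Algebra.Properties.Group (AbelianGroup.group ℤₚ.+-0-abelianGroup)
  using () renaming (∙-cancelˡ to ℤ-+-cancelˡ)
open import Data.Product using (_,_)
open import Function using (_∘_; case_of_)
open import Data.Sum using (_⊎_; inj₁; inj₂)
open import Level using (0ℓ)
open import Relation.Binary.PropositionalEquality
import Relation.Binary.Reasoning.Setoid
open import Relation.Nullary using (Dec; yes; no)
open import Data.Empty using (⊥-elim)

-- Finite sums of integers

sumTo-cong : ∀ {F G} n → (∀ i → i < n → F i ≡ G i) → sumTo F n ≡ sumTo G n
sumTo-cong zero    eq = refl
sumTo-cong (suc n) eq =
  cong₂ ℤ._+_ (sumTo-cong n (λ i i<n → eq i (ℕₚ.m<n⇒m<1+n i<n))) (eq n ℕₚ.≤-refl)

sumTo-zero : ∀ {F} n → (∀ i → i < n → F i ≡ 0ℤ) → sumTo F n ≡ 0ℤ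
sumTo-zero zero    eq = refl
sumTo-zero (suc n) eq =
  cong₂ ℤ._+_ (sumTo-zero n (λ i i<n → eq i (ℕₚ.m<n⇒m<1+n i<n))) (eq n ℕₚ.≤-refl)

sumTo-+ : ∀ F G n → sumTo (λ i → F i ℤ.+ G i) n ≡ sumTo F n ℤ.+ sumTo G n
sumTo-+ F G zero    = refl
sumTo-+ F G (suc n) =
  trans (cong (ℤ._+ (F n ℤ.+ G n)) (sumTo-+ F G n)) (ℤ-+-interchange (sumTo F n) (sumTo G n) (F n) (G n))

sumTo-*ˡ : ∀ c F n → sumTo (λ i → c ℤ.* F i) n ≡ c ℤ.* sumTo F n
sumTo-*ˡ c F zero    = sym (ℤₚ.*-zeroʳ c)
sumTo-*ˡ c F (suc n) =
  trans (cong (ℤ._+ c ℤ.* F n) (sumTo-*ˡ c F n)) (sym (ℤₚ.*-distribˡ-+ c (sumTo F n) (F n)))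

sumTo-*ʳ : ∀ c F n → sumTo (λ i → F i ℤ.* c) n ≡ sumTo F n ℤ.* c
sumTo-*ʳ c F n = begin
  sumTo (λ i → F i ℤ.* c) n  ≡⟨ sumTo-cong n (λ i _ → ℤₚ.*-comm (F i) c) ⟩
  sumTo (λ i → c ℤ.* F i) n  ≡⟨ sumTo-*ˡ c F n ⟩
  c ℤ.* sumTo F n            ≡⟨ ℤₚ.*-comm c (sumTo F n) ⟩
  sumTo F n ℤ.* c            ∎
  where open ≡-Reasoning

sumTo-suc : ∀ F n → sumTo F (suc n) ≡ F 0 ℤ.+ sumTo (F ∘ suc) n
sumTo-suc F zero    = trans (ℤₚ.+-identityˡ (F 0)) (sym (ℤₚ.+-identityʳ (F 0)))
sumTo-suc F (suc n) =
  trans (cong (ℤ._+ F (suc n)) (sumTo-suc F n)) (ℤₚ.+-assoc (F 0) _ (F (suc n)))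

sumTo-reverse : ∀ F n → sumTo F n ≡ sumTo (λ i → F (n ∸ suc i)) n
sumTo-reverse F zero    = refl
sumTo-reverse F (suc n) =
  trans (cong (ℤ._+ F n) (sumTo-reverse F n))
        (trans (ℤₚ.+-comm _ (F n)) (sym (sumTo-suc (λ i → F (suc n ∸ suc i)) n)))

sumTo-split : ∀ F m n → sumTo F (m + n) ≡ sumTo F m ℤ.+ sumTo (λ i → F (m + i)) n
sumTo-split F m zero    rewrite ℕₚ.+-identityʳ m = sym (ℤₚ.+-identityʳ (sumTo F m))
sumTo-split F m (suc n) rewrite ℕₚ.+-suc m n =
  trans (cong (ℤ._+ F (m + n)) (sumTo-split F m n)) (ℤₚ.+-assoc (sumTo F m) _ (F (m + n)))

sumTo-single : ∀ F n j → j < n → (∀ i → i < n → i ≢ j → F i ≡ 0ℤ) → sumTo F n ≡ F j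
sumTo-single F (suc n) j j<1+n others with j ≟ n
... | yes refl =
  trans (cong (ℤ._+ F n) (sumTo-zero n (λ i i<n → others i (ℕₚ.m<n⇒m<1+n i<n) (ℕₚ.<⇒≢ i<n))))
        (ℤₚ.+-identityˡ (F n))
... | no j≢n =
  trans (cong₂ ℤ._+_ (sumTo-single F n j (ℕₚ.≤∧≢⇒< (ℕₚ.≤-pred j<1+n) j≢n)
                                        (λ i i<n → others i (ℕₚ.m<n⇒m<1+n i<n)))
                     (others n ℕₚ.≤-refl (j≢n ∘ sym)))
        (ℤₚ.+-identityʳ (F j))

sumTo-triangle : ∀ (H : ℕ → ℕ → ℤ) N → sumTo (λ i → sumTo (λ a → H a i) (suc i)) N
                       ≡ sumTo (λ a → sumTo (λ b → H a (a + b)) (N ∸ a)) N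
sumTo-triangle H zero    = refl
sumTo-triangle H (suc N) = sym (begin
    sumTo (λ a → Row a (suc N ∸ a)) (suc N)
  ≡⟨ sumTo-cong (suc N) (λ a a<1+N → lastColumn a (ℕₚ.≤-pred a<1+N)) ⟩
    sumTo (λ a → Row a (N ∸ a) ℤ.+ H a N) (suc N)
  ≡⟨ sumTo-+ (λ a → Row a (N ∸ a)) (λ a → H a N) (suc N) ⟩
    sumTo (λ a → Row a (N ∸ a)) N ℤ.+ Row N (N ∸ N) ℤ.+ sumTo (λ a → H a N) (suc N)
  ≡⟨ cong (λ r → sumTo (λ a → Row a (N ∸ a)) N ℤ.+ Row N r ℤ.+ sumTo (λ a → H a N) (suc N))
          (ℕₚ.n∸n≡0 N) ⟩
    sumTo (λ a → Row a (N ∸ a)) N ℤ.+ 0ℤ ℤ.+ sumTo (λ a → H a N) (suc N)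
  ≡⟨ cong (ℤ._+ sumTo (λ a → H a N) (suc N))
          (trans (ℤₚ.+-identityʳ _) (sym (sumTo-triangle H N))) ⟩
    sumTo (λ i → sumTo (λ a → H a i) (suc i)) N ℤ.+ sumTo (λ a → H a N) (suc N)
  ∎)
  where
  open ≡-Reasoning
  Row : ℕ → ℕ → ℤ
  Row a = sumTo (λ b → H a (a + b))
  lastColumn : ∀ a → a ≤ N → Row a (suc N ∸ a) ≡ Row a (N ∸ a) ℤ.+ H a N
  lastColumn a a≤N rewrite ℕₚ.+-∸-assoc 1 a≤N = cong (λ c → Row a (N ∸ a) ℤ.+ H a c) (ℕₚ.m+[n∸m]≡n a≤N)

-- The ring ℤ[[q]]

infix 4 _≈_
record _≈_ (f g : Series) : Set where
  constructor pointwise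
  field at : ∀ n → f n ≡ g n
open _≈_ public

⊛-comm : ∀ f g → f ⊛ g ≈ g ⊛ f
⊛-comm f g = pointwise λ n → trans (sumTo-reverse (λ i → f i ℤ.* g (n ∸ i)) (suc n))
  (sumTo-cong (suc n) λ i i<1+n →
    trans (cong (λ j → f (n ∸ i) ℤ.* g j) (ℕₚ.m∸[m∸n]≡n (ℕₚ.≤-pred i<1+n)))
          (ℤₚ.*-comm (f (n ∸ i)) (g i)))

⊛-assoc : ∀ f g h → (f ⊛ g) ⊛ h ≈ f ⊛ (g ⊛ h)
⊛-assoc f g h = pointwise coefficient
  where
  row : ∀ {n} a → a ≤ n → sumTo (λ b → f a ℤ.* g (a + b ∸ a) ℤ.* h (n ∸ (a + b))) (suc n ∸ a)
                        ≡ f a ℤ.* sumTo (λ b → g b ℤ.* h (n ∸ a ∸ b)) (suc (n ∸ a))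
  row {n} a a≤n rewrite ℕₚ.+-∸-assoc 1 a≤n =
    trans (sumTo-cong (suc (n ∸ a)) λ b _ →
             trans (cong₂ (λ u v → f a ℤ.* g u ℤ.* h v) (ℕₚ.m+n∸m≡n a b) (sym (ℕₚ.∸-+-assoc n a b)))
                   (ℤₚ.*-assoc (f a) (g b) (h (n ∸ a ∸ b))))
          (sumTo-*ˡ (f a) (λ b → g b ℤ.* h (n ∸ a ∸ b)) (suc (n ∸ a)))
  coefficient : ∀ n → ((f ⊛ g) ⊛ h) n ≡ (f ⊛ (g ⊛ h)) n
  coefficient n = begin
      sumTo (λ i → sumTo (λ a → f a ℤ.* g (i ∸ a)) (suc i) ℤ.* h (n ∸ i)) (suc n)
    ≡⟨ sumTo-cong (suc n) (λ i _ → sym (sumTo-*ʳ (h (n ∸ i)) (λ a → f a ℤ.* g (i ∸ a)) (suc i))) ⟩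
      sumTo (λ i → sumTo (λ a → f a ℤ.* g (i ∸ a) ℤ.* h (n ∸ i)) (suc i)) (suc n)
    ≡⟨ sumTo-triangle (λ a i → f a ℤ.* g (i ∸ a) ℤ.* h (n ∸ i)) (suc n) ⟩
      sumTo (λ a → sumTo (λ b → f a ℤ.* g (a + b ∸ a) ℤ.* h (n ∸ (a + b))) (suc n ∸ a)) (suc n)
    ≡⟨ sumTo-cong (suc n) (λ a a<1+n → row a (ℕₚ.≤-pred a<1+n)) ⟩
      sumTo (λ a → f a ℤ.* sumTo (λ b → g b ℤ.* h (n ∸ a ∸ b)) (suc (n ∸ a))) (suc n)
    ∎
    where open ≡-Reasoning

⊛-distribˡ : ∀ f g h → f ⊛ (g ⊕ h) ≈ f ⊛ g ⊕ f ⊛ h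
⊛-distribˡ f g h = pointwise λ n →
  trans (sumTo-cong (suc n) (λ i _ → ℤₚ.*-distribˡ-+ (f i) (g (n ∸ i)) (h (n ∸ i))))
        (sumTo-+ (λ i → f i ℤ.* g (n ∸ i)) (λ i → f i ℤ.* h (n ∸ i)) (suc n))

⊛-distribʳ : ∀ f g h → (g ⊕ h) ⊛ f ≈ g ⊛ f ⊕ h ⊛ f
⊛-distribʳ f g h = pointwise λ n →
  trans (at (⊛-comm (g ⊕ h) f) n)
        (trans (at (⊛-distribˡ f g h) n) (cong₂ ℤ._+_ (at (⊛-comm f g) n) (at (⊛-comm f h) n)))

one-⊛ : ∀ f → one ⊛ f ≈ f
one-⊛ f = pointwise λ n →
  trans (sumTo-suc (λ i → one i ℤ.* f (n ∸ i)) n)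
        (trans (cong₂ ℤ._+_ (ℤₚ.*-identityˡ (f n)) (sumTo-zero n (λ i _ → ℤₚ.*-zeroˡ (f (n ∸ suc i)))))
               (ℤₚ.+-identityʳ (f n)))

seriesRing : CommutativeRing 0ℓ 0ℓ
seriesRing = record
  { Carrier = Series ; _≈_ = _≈_ ; _+_ = _⊕_ ; _*_ = _⊛_ ; -_ = negS ; 0# = zeroS ; 1# = one
  ; isCommutativeRing = record
    { isRing = record
      { +-isAbelianGroup = record
        { isGroup = record
          { isMonoid = record
            { isSemigroup = record
              { isMagma = record
                { isEquivalence = record
                  { refl  = pointwise λ _ → refl
                  ; sym   = λ p → pointwise λ n → sym (at p n)
                  ; trans = λ p q → pointwise λ n → trans (at p n) (at q n) }
                ; ∙-cong = λ p q → pointwise λ n → cong₂ ℤ._+_ (at p n) (at q n) }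
              ; assoc = λ f g h → pointwise λ n → ℤₚ.+-assoc (f n) (g n) (h n) }
            ; identity = (λ f → pointwise λ n → ℤₚ.+-identityˡ (f n))
                       , (λ f → pointwise λ n → ℤₚ.+-identityʳ (f n)) }
          ; inverse = (λ f → pointwise λ n → ℤₚ.+-inverseˡ (f n))
                    , (λ f → pointwise λ n → ℤₚ.+-inverseʳ (f n))
          ; ⁻¹-cong = λ p → pointwise λ n → cong ℤ.-_ (at p n) }
        ; comm = λ f g → pointwise λ n → ℤₚ.+-comm (f n) (g n) }
      ; *-cong = λ p q → pointwise λ n →
          sumTo-cong (suc n) (λ i _ → cong₂ ℤ._*_ (at p i) (at q (n ∸ i)))
      ; *-assoc = ⊛-assoc
      ; *-identity = one-⊛ , λ f → pointwise λ n → trans (at (⊛-comm f one) n) (at (one-⊛ f) n)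
      ; distrib = ⊛-distribˡ , ⊛-distribʳ }
    ; *-comm = ⊛-comm } }

open CommutativeRing seriesRing
  using ()
  renaming ( setoid to seriesSetoid; refl to ≈-refl; sym to ≈-sym; trans to ≈-trans; reflexive to ≈-reflexive
           ; +-cong to ⊕-cong; -‿cong to negS-cong; *-cong to ⊛-cong
           ; *-identityˡ to ⊛-identityˡ; *-identityʳ to ⊛-identityʳ
           ; zeroˡ to ⊛-zeroˡ; zeroʳ to ⊛-zeroʳ; +-identityʳ to ⊕-identityʳ )
module ≈-Reasoning = Relation.Binary.Reasoning.Setoid seriesSetoid

⊛-congˡ : ∀ f {g g′} → g ≈ g′ → f ⊛ g ≈ f ⊛ g′
⊛-congˡ f g≈g′ = ⊛-cong (≈-refl {f}) g≈g′

⊛-congʳ : ∀ g {f f′} → f ≈ f′ → f ⊛ g ≈ f′ ⊛ g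
⊛-congʳ g f≈f′ = ⊛-cong f≈f′ (≈-refl {g})

-- 0 and 1 are special-cased to be definitionally zeroS and one: the ring solver's
-- constants must match the goal syntactically.
constS : ℤ → Series
constS (ℤ.+ 0) = zeroS
constS (ℤ.+ 1) = one
constS c       = λ n → c ℤ.* one n

constS-scales : ∀ c n → constS c n ≡ c ℤ.* one n
constS-scales (ℤ.+ 0)           n = refl
constS-scales (ℤ.+ 1)           n = sym (ℤₚ.*-identityˡ (one n))
constS-scales (ℤ.+ suc (suc k)) n = refl
constS-scales (ℤ.-[1+ k ])      n = refl

constS-⊛ : ∀ c f n → (constS c ⊛ f) n ≡ c ℤ.* f n
constS-⊛ c f n = begin
    sumTo (λ i → constS c i ℤ.* f (n ∸ i)) (suc n)
  ≡⟨ sumTo-cong (suc n) (λ i _ → trans (cong (ℤ._* f (n ∸ i)) (constS-scales c i))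
                                        (ℤₚ.*-assoc c (one i) (f (n ∸ i)))) ⟩
    sumTo (λ i → c ℤ.* (one i ℤ.* f (n ∸ i))) (suc n)
  ≡⟨ sumTo-*ˡ c (λ i → one i ℤ.* f (n ∸ i)) (suc n) ⟩
    c ℤ.* (one ⊛ f) n
  ≡⟨ cong (c ℤ.*_) (at (one-⊛ f) n) ⟩
    c ℤ.* f n
  ∎
  where open ≡-Reasoning

constS-* : ∀ a b → constS (a ℤ.* b) ≈ constS a ⊛ constS b
constS-* a b = pointwise λ n → trans (constS-scales (a ℤ.* b) n)
  (trans (ℤₚ.*-assoc a b (one n))
         (trans (cong (a ℤ.*_) (sym (constS-scales b n))) (sym (constS-⊛ a (constS b) n))))

module SeriesSolver where
  open import Algebra.Solver.Ring.AlmostCommutativeRing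
    using (AlmostCommutativeRing; _-Raw-AlmostCommutative⟶_; fromCommutativeRing)
  open import Data.Maybe using (nothing)

  constS-homomorphism : ℤ.+-*-rawRing -Raw-AlmostCommutative⟶ fromCommutativeRing seriesRing
  constS-homomorphism = record
    { ⟦_⟧    = constS
    ; +-homo = λ a b → pointwise λ n → trans (constS-scales (a ℤ.+ b) n)
        (trans (ℤₚ.*-distribʳ-+ (one n) a b) (sym (cong₂ ℤ._+_ (constS-scales a n) (constS-scales b n))))
    ; *-homo = constS-*
    ; -‿homo = λ a → pointwise λ n → trans (constS-scales (ℤ.- a) n)
        (trans (sym (ℤₚ.neg-distribˡ-* a (one n))) (cong ℤ.-_ (sym (constS-scales a n))))
    ; 0-homo = pointwise λ _ → refl
    ; 1-homo = pointwise λ _ → refl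
    }

  open import Algebra.Solver.Ring ℤ.+-*-rawRing (fromCommutativeRing seriesRing)
    constS-homomorphism (λ _ _ → nothing) public
    using (solve; _:+_; _:*_; _:-_; :-_; con; _:=_)

open SeriesSolver using (solve; _:+_; _:*_; _:-_; :-_; con; _:=_)

mono-diag : ∀ d → mono d d ≡ 1ℤ
mono-diag zero    = refl
mono-diag (suc d) = mono-diag d

mono-off : ∀ d n → d ≢ n → mono d n ≡ 0ℤ
mono-off zero    zero    d≢n = ⊥-elim (d≢n refl)
mono-off zero    (suc n) d≢n = refl
mono-off (suc d) zero    d≢n = refl
mono-off (suc d) (suc n) d≢n = mono-off d n (d≢n ∘ cong suc)

mono-⊛-≥ : ∀ d f n → d ≤ n → (mono d ⊛ f) n ≡ f (n ∸ d)
mono-⊛-≥ d f n d≤n =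
  trans (sumTo-single (λ i → mono d i ℤ.* f (n ∸ i)) (suc n) d (s≤s d≤n)
           (λ i _ i≢d → trans (cong (ℤ._* f (n ∸ i)) (mono-off d i (i≢d ∘ sym))) (ℤₚ.*-zeroˡ (f (n ∸ i)))))
        (trans (cong (ℤ._* f (n ∸ d)) (mono-diag d)) (ℤₚ.*-identityˡ (f (n ∸ d))))

mono-⊛-< : ∀ d f n → n < d → (mono d ⊛ f) n ≡ 0ℤ
mono-⊛-< d f n n<d = sumTo-zero (suc n) λ i i≤n →
  trans (cong (ℤ._* f (n ∸ i)) (mono-off d i (ℕₚ.>⇒≢ (ℕₚ.≤-<-trans (ℕₚ.≤-pred i≤n) n<d))))
        (ℤₚ.*-zeroˡ (f (n ∸ i)))

mono-+ : ∀ a b → mono a ⊛ mono b ≈ mono (a + b)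
mono-+ a b = pointwise coefficient
  where
  coefficient : ∀ n → (mono a ⊛ mono b) n ≡ mono (a + b) n
  coefficient n with a ≤? n
  ... | no a≰n = trans (mono-⊛-< a (mono b) n (ℕₚ.≰⇒> a≰n))
                       (sym (mono-off (a + b) n λ a+b≡n → a≰n (subst (a ≤_) a+b≡n (ℕₚ.m≤m+n a b))))
  ... | yes a≤n with b ≟ n ∸ a
  ...   | yes refl = trans (mono-⊛-≥ a (mono (n ∸ a)) n a≤n)
                           (trans (mono-diag (n ∸ a))
                                  (sym (trans (cong (λ d → mono d n) (ℕₚ.m+[n∸m]≡n a≤n)) (mono-diag n))))
  ...   | no b≢n∸a = trans (mono-⊛-≥ a (mono b) n a≤n)
                           (trans (mono-off b (n ∸ a) b≢n∸a)
                                  (sym (mono-off (a + b) n λ a+b≡n →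
                                          b≢n∸a (trans (sym (ℕₚ.m+n∸m≡n a b)) (cong (_∸ a) a+b≡n)))))

infix 4 q^_∣_
q^_∣_ : ℕ → Series → Set
q^ N ∣ f = ∀ n → n < N → f n ≡ 0ℤ

DegreeAtMost : ℕ → Series → Set
DegreeAtMost d f = ∀ n → d < n → f n ≡ 0ℤ

infix 4 _≈[_]_
record _≈[_]_ (f : Series) (N : ℕ) (g : Series) : Set where
  constructor below
  field at< : ∀ n → n < N → f n ≡ g n
open _≈[_]_ public

⊛-vanishes : ∀ f g n → (∀ i → i ≤ n → f i ≡ 0ℤ ⊎ g (n ∸ i) ≡ 0ℤ) → (f ⊛ g) n ≡ 0ℤ
⊛-vanishes f g n factor = sumTo-zero (suc n) λ i i≤n → term i (factor i (ℕₚ.≤-pred i≤n))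
  where
  term : ∀ i → f i ≡ 0ℤ ⊎ g (n ∸ i) ≡ 0ℤ → f i ℤ.* g (n ∸ i) ≡ 0ℤ
  term i (inj₁ fi≡0) = trans (cong (ℤ._* g (n ∸ i)) fi≡0) (ℤₚ.*-zeroˡ (g (n ∸ i)))
  term i (inj₂ gj≡0) = trans (cong (f i ℤ.*_) gj≡0) (ℤₚ.*-zeroʳ (f i))

q^∣-mono : ∀ d → q^ d ∣ mono d
q^∣-mono d n n<d = mono-off d n (ℕₚ.>⇒≢ n<d)

q^∣-⊕ : ∀ {N f g} → q^ N ∣ f → q^ N ∣ g → q^ N ∣ f ⊕ g
q^∣-⊕ p q n n<N = cong₂ ℤ._+_ (p n n<N) (q n n<N)

q^∣-weaken : ∀ {M N f} → M ≤ N → q^ N ∣ f → q^ M ∣ f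
q^∣-weaken M≤N p n n<M = p n (ℕₚ.<-≤-trans n<M M≤N)

q^∣-resp-≈ : ∀ {N f g} → f ≈ g → q^ N ∣ f → q^ N ∣ g
q^∣-resp-≈ f≈g p n n<N = trans (sym (at f≈g n)) (p n n<N)

q^∣-⊛ : ∀ {a b f g} → q^ a ∣ f → q^ b ∣ g → q^ (a + b) ∣ f ⊛ g
q^∣-⊛ {a} {b} {f} {g} p q n n<a+b = ⊛-vanishes f g n factor
  where
  open ℕₚ.≤-Reasoning
  factor : ∀ i → i ≤ n → f i ≡ 0ℤ ⊎ g (n ∸ i) ≡ 0ℤ
  factor i i≤n with i <? a
  ... | yes i<a = inj₁ (p i i<a)
  ... | no i≮a  = inj₂ (q (n ∸ i) (ℕₚ.+-cancelˡ-< i (n ∸ i) b (begin-strict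
    i + (n ∸ i)  ≡⟨ ℕₚ.m+[n∸m]≡n i≤n ⟩
    n            <⟨ n<a+b ⟩
    a + b        ≤⟨ ℕₚ.+-monoˡ-≤ b (ℕₚ.≮⇒≥ i≮a) ⟩
    i + b        ∎)))

q^∣-⊛ˡ : ∀ {a f} g → q^ a ∣ f → q^ a ∣ f ⊛ g
q^∣-⊛ˡ {a} g p = subst (λ N → q^ N ∣ _) (ℕₚ.+-identityʳ a) (q^∣-⊛ {b = 0} {g = g} p (λ _ ()))

q^∣-⊛ʳ : ∀ {a g} f → q^ a ∣ g → q^ a ∣ f ⊛ g
q^∣-⊛ʳ f p = q^∣-⊛ {a = 0} {f = f} (λ _ ()) p

degree-mono : ∀ d → DegreeAtMost d (mono d)
degree-mono d n d<n = mono-off d n (ℕₚ.<⇒≢ d<n)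

degree-⊕ : ∀ {d f g} → DegreeAtMost d f → DegreeAtMost d g → DegreeAtMost d (f ⊕ g)
degree-⊕ p q n d<n = cong₂ ℤ._+_ (p n d<n) (q n d<n)

degree-negS : ∀ {d f} → DegreeAtMost d f → DegreeAtMost d (negS f)
degree-negS p n d<n = cong ℤ.-_ (p n d<n)

degree-weaken : ∀ {d e f} → d ≤ e → DegreeAtMost d f → DegreeAtMost e f
degree-weaken d≤e p n e<n = p n (ℕₚ.≤-<-trans d≤e e<n)

degree-resp-≈ : ∀ {d f g} → f ≈ g → DegreeAtMost d f → DegreeAtMost d g
degree-resp-≈ f≈g p n d<n = trans (sym (at f≈g n)) (p n d<n)

degree-⊛ : ∀ {a b f g} → DegreeAtMost a f → DegreeAtMost b g → DegreeAtMost (a + b) (f ⊛ g)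
degree-⊛ {a} {b} {f} {g} p q n a+b<n = ⊛-vanishes f g n factor
  where
  open ℕₚ.≤-Reasoning
  factor : ∀ i → i ≤ n → f i ≡ 0ℤ ⊎ g (n ∸ i) ≡ 0ℤ
  factor i i≤n with i ≤? a
  ... | no i≰a  = inj₁ (p i (ℕₚ.≰⇒> i≰a))
  ... | yes i≤a = inj₂ (q (n ∸ i) (ℕₚ.+-cancelˡ-< i b (n ∸ i) (begin-strict
    i + b        ≤⟨ ℕₚ.+-monoˡ-≤ b i≤a ⟩
    a + b        <⟨ a+b<n ⟩
    n            ≡⟨ sym (ℕₚ.m+[n∸m]≡n i≤n) ⟩
    i + (n ∸ i)  ∎)))

degree-one : ∀ d → DegreeAtMost d one
degree-one d = degree-weaken z≤n (degree-mono 0)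

degree-one-minus-mono : ∀ a → DegreeAtMost a (one ⊖ mono a)
degree-one-minus-mono a = degree-⊕ (degree-one a) (degree-negS (degree-mono a))

≈⇒≈[] : ∀ {f g} N → f ≈ g → f ≈[ N ] g
≈⇒≈[] N f≈g = below λ n _ → at f≈g n

≈[]-sym : ∀ {f g N} → f ≈[ N ] g → g ≈[ N ] f
≈[]-sym p = below λ n n<N → sym (at< p n n<N)

≈[]-trans : ∀ {f g h N} → f ≈[ N ] g → g ≈[ N ] h → f ≈[ N ] h
≈[]-trans p q = below λ n n<N → trans (at< p n n<N) (at< q n n<N)

≈[]-weaken : ∀ {f g M N} → M ≤ N → f ≈[ N ] g → f ≈[ M ] g
≈[]-weaken M≤N p = below λ n n<M → at< p n (ℕₚ.<-≤-trans n<M M≤N)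

≈[]-⊕ : ∀ {f f′ g g′ N} → f ≈[ N ] f′ → g ≈[ N ] g′ → f ⊕ g ≈[ N ] f′ ⊕ g′
≈[]-⊕ p q = below λ n n<N → cong₂ ℤ._+_ (at< p n n<N) (at< q n n<N)

≈[]-⊛ : ∀ {f f′ g g′ N} → f ≈[ N ] f′ → g ≈[ N ] g′ → f ⊛ g ≈[ N ] f′ ⊛ g′
≈[]-⊛ p q = below λ n n<N → sumTo-cong (suc n) λ i i≤n →
  cong₂ ℤ._*_ (at< p i (ℕₚ.≤-<-trans (ℕₚ.≤-pred i≤n) n<N)) (at< q (n ∸ i) (ℕₚ.≤-<-trans (ℕₚ.m∸n≤m n i) n<N))

≈[]-refl : ∀ {f N} → f ≈[ N ] f
≈[]-refl = below λ _ _ → refl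

q^∣-⊖⇒≈[] : ∀ {N f g} → q^ N ∣ f ⊖ g → f ≈[ N ] g
q^∣-⊖⇒≈[] {N} {f} {g} p = below coefficient
  where
  coefficient : ∀ n → n < N → f n ≡ g n
  coefficient n n<N = begin
    f n                        ≡⟨ sym (ℤₚ.+-identityʳ (f n)) ⟩
    f n ℤ.+ 0ℤ                 ≡⟨ cong (λ z → f n ℤ.+ z) (sym (ℤₚ.+-inverseˡ (g n))) ⟩
    f n ℤ.+ (ℤ.- g n ℤ.+ g n)  ≡⟨ sym (ℤₚ.+-assoc (f n) (ℤ.- g n) (g n)) ⟩
    (f ⊖ g) n ℤ.+ g n          ≡⟨ cong (ℤ._+ g n) (p n n<N) ⟩
    0ℤ ℤ.+ g n                 ≡⟨ ℤₚ.+-identityˡ (g n) ⟩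
    g n                        ∎
    where open ≡-Reasoning

≈[]⇒q^∣-⊖ : ∀ {N f g} → f ≈[ N ] g → q^ N ∣ f ⊖ g
≈[]⇒q^∣-⊖ {g = g} f≈g n n<N =
  trans (cong (ℤ._+ ℤ.- g n) (at< f≈g n n<N)) (ℤₚ.+-inverseʳ (g n))

⊛-≈[]-one : ∀ {a b f g} → q^ a ∣ f → g ≈[ b ] one → f ⊛ g ≈[ a + b ] f
⊛-≈[]-one {a} {b} {f} {g} q^a∣f g≈1 = q^∣-⊖⇒≈[]
  (q^∣-resp-≈ (solve 2 (λ f g → f :* (g :- con 1ℤ) := f :* g :- f) ≈-refl f g)
              (q^∣-⊛ {a} {b} {f} q^a∣f (≈[]⇒q^∣-⊖ g≈1)))

one-minus-mono-≈[] : ∀ {N a} → N ≤ a → one ⊖ mono a ≈[ N ] one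
one-minus-mono-≈[] {N} {a} N≤a = below λ n n<N →
  trans (cong (λ c → one n ℤ.+ ℤ.- c) (q^∣-mono a n (ℕₚ.<-≤-trans n<N N≤a))) (ℤₚ.+-identityʳ (one n))

⊛-cancelʳ-≈[] : ∀ {f g D} N → D 0 ≡ 1ℤ → f ⊛ D ≈[ N ] g ⊛ D → f ≈[ N ] g
⊛-cancelʳ-≈[] zero    D0≡1 eq = below λ _ ()
⊛-cancelʳ-≈[] {f} {g} {D} (suc N) D0≡1 eq = below coefficient
  where
  IH : f ≈[ N ] g
  IH = ⊛-cancelʳ-≈[] {D = D} N D0≡1 (≈[]-weaken (ℕₚ.n≤1+n N) eq)
  D[N∸N]≡1 : D (N ∸ N) ≡ 1ℤ
  D[N∸N]≡1 = trans (cong D (ℕₚ.n∸n≡0 N)) D0≡1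
  lastTerms : sumTo (λ i → f i ℤ.* D (N ∸ i)) N ℤ.+ f N ℤ.* D (N ∸ N)
            ≡ sumTo (λ i → f i ℤ.* D (N ∸ i)) N ℤ.+ g N ℤ.* D (N ∸ N)
  lastTerms = trans (at< eq N ℕₚ.≤-refl)
    (cong (ℤ._+ g N ℤ.* D (N ∸ N)) (sumTo-cong N λ i i<N → cong (ℤ._* D (N ∸ i)) (sym (at< IH i i<N))))
  top : f N ≡ g N
  top = begin
    f N                  ≡⟨ sym (ℤₚ.*-identityʳ (f N)) ⟩
    f N ℤ.* 1ℤ           ≡⟨ cong (f N ℤ.*_) (sym D[N∸N]≡1) ⟩
    f N ℤ.* D (N ∸ N)    ≡⟨ ℤ-+-cancelˡ (sumTo (λ i → f i ℤ.* D (N ∸ i)) N) _ _ lastTerms ⟩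
    g N ℤ.* D (N ∸ N)    ≡⟨ cong (g N ℤ.*_) D[N∸N]≡1 ⟩
    g N ℤ.* 1ℤ           ≡⟨ ℤₚ.*-identityʳ (g N) ⟩
    g N                  ∎
    where open ≡-Reasoning
  coefficient : ∀ n → n < suc N → f n ≡ g n
  coefficient n n<1+N with n <? N
  ... | yes n<N = at< IH n n<N
  ... | no n≮N rewrite ℕₚ.≤-antisym (ℕₚ.≤-pred n<1+N) (ℕₚ.≮⇒≥ n≮N) = top

⊛-cancelʳ : ∀ {f g D} → D 0 ≡ 1ℤ → f ⊛ D ≈ g ⊛ D → f ≈ g
⊛-cancelʳ {f} {g} {D} D0≡1 eq =
  pointwise λ n → ⊛-cancelʳ-≈[] {f} {g} {D} (suc n) D0≡1 (≈⇒≈[] (suc n) eq) .at< n ℕₚ.≤-refl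

sumToℕ : (ℕ → ℕ) → ℕ → ℕ
sumToℕ D zero    = 0
sumToℕ D (suc n) = sumToℕ D n + D n

prodS-cong : ∀ {F G} n → (∀ j → j < n → F j ≈ G j) → prodS F n ≈ prodS G n
prodS-cong zero    eq = ≈-refl
prodS-cong (suc n) eq = ⊛-cong (prodS-cong n (λ j j<n → eq j (ℕₚ.m<n⇒m<1+n j<n))) (eq n ℕₚ.≤-refl)

prodS-⊛ : ∀ F G n → prodS (λ j → F j ⊛ G j) n ≈ prodS F n ⊛ prodS G n
prodS-⊛ F G zero    = ≈-sym (⊛-identityˡ one)
prodS-⊛ F G (suc n) = ≈-trans (⊛-congʳ (F n ⊛ G n) (prodS-⊛ F G n))
  (solve 4 (λ a b c d → (a :* b) :* (c :* d) := (a :* c) :* (b :* d)) ≈-refl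
     (prodS F n) (prodS G n) (F n) (G n))

prodS-suc : ∀ F n → prodS F (suc n) ≈ F 0 ⊛ prodS (F ∘ suc) n
prodS-suc F zero    = ≈-trans (⊛-identityˡ (F 0)) (≈-sym (⊛-identityʳ (F 0)))
prodS-suc F (suc n) =
  ≈-trans (⊛-congʳ (F (suc n)) (prodS-suc F n)) (⊛-assoc (F 0) (prodS (F ∘ suc) n) (F (suc n)))

prodS-reverse : ∀ F n → prodS F n ≈ prodS (λ j → F (n ∸ suc j)) n
prodS-reverse F zero    = ≈-refl
prodS-reverse F (suc n) = ≈-trans (⊛-congʳ (F n) (prodS-reverse F n))
  (≈-trans (⊛-comm (prodS (λ j → F (n ∸ suc j)) n) (F n))
           (≈-sym (prodS-suc (λ j → F (suc n ∸ suc j)) n)))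

prodS-one : ∀ n → prodS (λ _ → one) n ≈ one
prodS-one zero    = ≈-refl
prodS-one (suc n) = ≈-trans (⊛-identityʳ _) (prodS-one n)

degree-prodS : ∀ D F n → (∀ j → j < n → DegreeAtMost (D j) (F j)) →
               DegreeAtMost (sumToℕ D n) (prodS F n)
degree-prodS D F zero    deg = degree-mono 0
degree-prodS D F (suc n) deg =
  degree-⊛ (degree-prodS D F n (λ j j<n → deg j (ℕₚ.m<n⇒m<1+n j<n))) (deg n ℕₚ.≤-refl)

q^∣-one-minus-prodS : ∀ N F n → (∀ j → j < n → q^ N ∣ one ⊖ F j) → q^ N ∣ one ⊖ prodS F n
q^∣-one-minus-prodS N F zero    _   k _ = ℤₚ.+-inverseʳ (one k)
q^∣-one-minus-prodS N F (suc n) div =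
  q^∣-resp-≈ (solve 2 (λ A f → (con 1ℤ :- A) :+ A :* (con 1ℤ :- f) := con 1ℤ :- A :* f) ≈-refl
                (prodS F n) (F n))
    (q^∣-⊕ (q^∣-one-minus-prodS N F n (λ j j<n → div j (ℕₚ.m<n⇒m<1+n j<n)))
           (q^∣-⊛ʳ (prodS F n) (div n ℕₚ.≤-refl)))

signS-+ : ∀ a b → signS (a + b) ≈ signS a ⊛ signS b
signS-+ zero    b = ≈-sym (⊛-identityˡ (signS b))
signS-+ (suc a) b = ≈-trans (negS-cong (signS-+ a b))
  (solve 2 (λ s t → :- (s :* t) := (:- s) :* t) ≈-refl (signS a) (signS b))

signS-square : ∀ n → signS n ⊛ signS n ≈ one
signS-square zero    = ⊛-identityˡ one
signS-square (suc n) =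
  ≈-trans (solve 1 (λ s → (:- s) :* (:- s) := s :* s) ≈-refl (signS n)) (signS-square n)

degree-signS : ∀ n → DegreeAtMost 0 (signS n)
degree-signS zero    = degree-mono 0
degree-signS (suc n) = degree-negS (degree-signS n)

prodS-negS : ∀ F n → prodS (λ j → negS (F j)) n ≈ signS n ⊛ prodS F n
prodS-negS F zero    = ≈-sym (⊛-identityˡ one)
prodS-negS F (suc n) = ≈-trans (⊛-congʳ (negS (F n)) (prodS-negS F n))
  (solve 3 (λ s p f → (s :* p) :* (:- f) := (:- s) :* (p :* f)) ≈-refl (signS n) (prodS F n) (F n))

cancel-signS : ∀ n f p q → f ⊛ (signS n ⊛ p) ≈ signS n ⊛ q → f ⊛ p ≈ q
cancel-signS n f p q eq = begin
  f ⊛ p                      ≈⟨ ⊛-identityˡ (f ⊛ p) ⟨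
  one ⊛ (f ⊛ p)              ≈⟨ ⊛-congʳ (f ⊛ p) (signS-square n) ⟨
  (s ⊛ s) ⊛ (f ⊛ p)          ≈⟨ solve 3 (λ s f p → (s :* s) :* (f :* p) := s :* (f :* (s :* p)))
                                       ≈-refl s f p ⟩
  s ⊛ (f ⊛ (s ⊛ p))          ≈⟨ ⊛-congˡ s eq ⟩
  s ⊛ (s ⊛ q)                ≈⟨ ⊛-assoc s s q ⟨
  (s ⊛ s) ⊛ q                ≈⟨ ⊛-congʳ q (signS-square n) ⟩
  one ⊛ q                    ≈⟨ ⊛-identityˡ q ⟩
  q                          ∎
  where
  open ≈-Reasoning
  s = signS n

mono-minus-one : ∀ a → mono a ⊖ one ≈ negS (one ⊖ mono a)
mono-minus-one a = solve 1 (λ x → x :- con 1ℤ := :- (con 1ℤ :- x)) ≈-refl (mono a)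

prodS-mono-minus-one : ∀ (D : ℕ → ℕ) n →
  prodS (λ j → mono (D j) ⊖ one) n ≈ signS n ⊛ prodS (λ j → one ⊖ mono (D j)) n
prodS-mono-minus-one D n = ≈-trans
  (prodS-cong n λ j _ → mono-minus-one (D j))
  (prodS-negS (λ j → one ⊖ mono (D j)) n)

sumS-cong : ∀ {F G} n → (∀ j → j < n → F j ≈ G j) → sumS F n ≈ sumS G n
sumS-cong zero    eq = ≈-refl
sumS-cong (suc n) eq = ⊕-cong (sumS-cong n (λ j j<n → eq j (ℕₚ.m<n⇒m<1+n j<n))) (eq n ℕₚ.≤-refl)

sumS-cong-≈[] : ∀ {F G N} n → (∀ j → j < n → F j ≈[ N ] G j) → sumS F n ≈[ N ] sumS G n
sumS-cong-≈[] zero    eq = below λ _ _ → refl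
sumS-cong-≈[] (suc n) eq =
  ≈[]-⊕ (sumS-cong-≈[] n (λ j j<n → eq j (ℕₚ.m<n⇒m<1+n j<n))) (eq n ℕₚ.≤-refl)

sumS-suc : ∀ F n → sumS F (suc n) ≈ F 0 ⊕ sumS (F ∘ suc) n
sumS-suc F zero    = pointwise λ k → trans (ℤₚ.+-identityˡ (F 0 k)) (sym (ℤₚ.+-identityʳ (F 0 k)))
sumS-suc F (suc n) = ≈-trans (⊕-cong (sumS-suc F n) ≈-refl)
  (pointwise λ k → ℤₚ.+-assoc (F 0 k) (sumS (F ∘ suc) n k) (F (suc n) k))

sumS-⊕ : ∀ F G n → sumS (λ i → F i ⊕ G i) n ≈ sumS F n ⊕ sumS G n
sumS-⊕ F G zero    = ≈-refl
sumS-⊕ F G (suc n) = ≈-trans (⊕-cong (sumS-⊕ F G n) ≈-refl)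
  (pointwise λ k → ℤ-+-interchange (sumS F n k) (sumS G n k) (F n k) (G n k))

sumS-negS : ∀ F n → sumS (λ i → negS (F i)) n ≈ negS (sumS F n)
sumS-negS F zero    = ≈-refl
sumS-negS F (suc n) = pointwise λ k →
  trans (cong (ℤ._+ ℤ.- F n k) (at (sumS-negS F n) k)) (sym (ℤₚ.neg-distrib-+ (sumS F n k) (F n k)))

⊛-sumS : ∀ c F n → c ⊛ sumS F n ≈ sumS (λ i → c ⊛ F i) n
⊛-sumS c F zero    = ⊛-zeroʳ c
⊛-sumS c F (suc n) = ≈-trans (⊛-distribˡ c (sumS F n) (F n)) (⊕-cong (⊛-sumS c F n) ≈-refl)

sumS-⊛-sumS : ∀ F G m n → sumS F m ⊛ sumS G n ≈ sumS (λ i → sumS (λ j → F i ⊛ G j) n) m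
sumS-⊛-sumS F G m n = ≈-trans (⊛-comm (sumS F m) (sumS G n))
  (≈-trans (⊛-sumS (sumS G n) F m)
    (sumS-cong m λ i _ → ≈-trans (⊛-comm (sumS G n) (F i)) (⊛-sumS (F i) G n)))

degree-sumS : ∀ d F n → (∀ i → i < n → DegreeAtMost d (F i)) → DegreeAtMost d (sumS F n)
degree-sumS d F zero    deg k _ = refl
degree-sumS d F (suc n) deg =
  degree-⊕ (degree-sumS d F n (λ i i<n → deg i (ℕₚ.m<n⇒m<1+n i<n))) (deg n ℕₚ.≤-refl)

sumS-at : ∀ F n k → sumS F n k ≡ sumTo (λ i → F i k) n
sumS-at F zero    k = refl
sumS-at F (suc n) k = cong (ℤ._+ F n k) (sumS-at F n k)

-- Reciprocal polynomials

-- reverse d f = q^d · f(1/q), the reciprocal of f regarded as a polynomial of degree d.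
reverse : ℕ → Series → Series
reverse d f n with n ≤? d
... | yes _ = f (d ∸ n)
... | no  _ = 0ℤ

reverse-≤ : ∀ {d f n} → n ≤ d → reverse d f n ≡ f (d ∸ n)
reverse-≤ {d} {f} {n} n≤d with n ≤? d
... | yes _   = refl
... | no n≰d  = ⊥-elim (n≰d n≤d)

reverse-> : ∀ {d f n} → d < n → reverse d f n ≡ 0ℤ
reverse-> {d} {f} {n} d<n with n ≤? d
... | yes n≤d = ⊥-elim (ℕₚ.<⇒≱ d<n n≤d)
... | no _    = refl

reverse-cong : ∀ d {f g} → f ≈ g → reverse d f ≈ reverse d g
reverse-cong d {f} {g} f≈g = pointwise λ n → case n ≤? d of λ where
  (yes n≤d) → trans (reverse-≤ n≤d) (trans (at f≈g (d ∸ n)) (sym (reverse-≤ n≤d)))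
  (no n≰d)  → trans (reverse-> (ℕₚ.≰⇒> n≰d)) (sym (reverse-> (ℕₚ.≰⇒> n≰d)))

reverse-⊕ : ∀ d f g → reverse d (f ⊕ g) ≈ reverse d f ⊕ reverse d g
reverse-⊕ d f g = pointwise λ n → case n ≤? d of λ where
  (yes n≤d) → trans (reverse-≤ n≤d) (sym (cong₂ ℤ._+_ (reverse-≤ n≤d) (reverse-≤ n≤d)))
  (no n≰d)  → let d<n = ℕₚ.≰⇒> n≰d in
    trans (reverse-> d<n) (sym (cong₂ ℤ._+_ (reverse-> d<n) (reverse-> d<n)))

reverse-negS : ∀ d f → reverse d (negS f) ≈ negS (reverse d f)
reverse-negS d f = pointwise λ n → case n ≤? d of λ where
  (yes n≤d) → trans (reverse-≤ n≤d) (sym (cong ℤ.-_ (reverse-≤ n≤d)))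
  (no n≰d)  → trans (reverse-> (ℕₚ.≰⇒> n≰d)) (sym (cong ℤ.-_ (reverse-> (ℕₚ.≰⇒> n≰d))))

reverse-⊖ : ∀ d f g → reverse d (f ⊖ g) ≈ reverse d f ⊖ reverse d g
reverse-⊖ d f g = ≈-trans (reverse-⊕ d f (negS g)) (⊕-cong (≈-refl {reverse d f}) (reverse-negS d g))

reverse-sumS : ∀ d F n → reverse d (sumS F n) ≈ sumS (λ i → reverse d (F i)) n
reverse-sumS d F zero    = pointwise λ k → case k ≤? d of λ where
  (yes k≤d) → reverse-≤ k≤d
  (no k≰d)  → reverse-> (ℕₚ.≰⇒> k≰d)
reverse-sumS d F (suc n) =
  ≈-trans (reverse-⊕ d (sumS F n) (F n)) (⊕-cong (reverse-sumS d F n) ≈-refl)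

monomial : ℤ → ℕ → Series
monomial c i = constS c ⊛ mono i

monomial-⊛ : ∀ c c′ i j → monomial c i ⊛ monomial c′ j ≈ monomial (c ℤ.* c′) (i + j)
monomial-⊛ c c′ i j = ≈-trans
  (solve 4 (λ x x′ y y′ → (x :* y) :* (x′ :* y′) := (x :* x′) :* (y :* y′)) ≈-refl
     (constS c) (constS c′) (mono i) (mono j))
  (⊛-cong (≈-sym (constS-* c c′)) (mono-+ i j))

mono-reflect : ∀ {d i n} → i ≤ d → n ≤ d → mono i (d ∸ n) ≡ mono (d ∸ i) n
mono-reflect {d} {i} {n} i≤d n≤d with i ≟ d ∸ n
... | yes refl = trans (mono-diag (d ∸ n)) (sym (trans (cong (λ e → mono e n) (ℕₚ.m∸[m∸n]≡n n≤d))
                                                       (mono-diag n)))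
... | no i≢d∸n = trans (mono-off i (d ∸ n) i≢d∸n)
  (sym (mono-off (d ∸ i) n λ d∸i≡n →
          i≢d∸n (trans (sym (ℕₚ.m∸[m∸n]≡n i≤d)) (cong (d ∸_) d∸i≡n))))

reverse-monomial : ∀ c {d i} → i ≤ d → reverse d (monomial c i) ≈ monomial c (d ∸ i)
reverse-monomial c {d} {i} i≤d = pointwise λ n → case n ≤? d of λ where
  (yes n≤d) → trans (reverse-≤ n≤d) (trans (constS-⊛ c (mono i) (d ∸ n))
                (trans (cong (c ℤ.*_) (mono-reflect i≤d n≤d)) (sym (constS-⊛ c (mono (d ∸ i)) n))))
  (no n≰d)  → trans (reverse-> (ℕₚ.≰⇒> n≰d))
                (sym (trans (constS-⊛ c (mono (d ∸ i)) n)
                       (trans (cong (c ℤ.*_) (degree-mono (d ∸ i) n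
                                 (ℕₚ.≤-<-trans (ℕₚ.m∸n≤m d i) (ℕₚ.≰⇒> n≰d))))
                              (ℤₚ.*-zeroʳ c))))

reverse-mono : ∀ {d i} → i ≤ d → reverse d (mono i) ≈ mono (d ∸ i)
reverse-mono {d} {i} i≤d = begin
  reverse d (mono i)       ≈⟨ reverse-cong d (⊛-identityˡ (mono i)) ⟨
  reverse d (one ⊛ mono i) ≈⟨ reverse-monomial 1ℤ i≤d ⟩
  one ⊛ mono (d ∸ i)       ≈⟨ ⊛-identityˡ (mono (d ∸ i)) ⟩
  mono (d ∸ i)             ∎
  where open ≈-Reasoning

monomial-expansion : ∀ {a f} → DegreeAtMost a f → f ≈ sumS (λ i → monomial (f i) i) (suc a)
monomial-expansion {a} {f} deg = pointwise λ n → sym (trans (sumS-at (λ i → monomial (f i) i) (suc a) n)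
  (trans (sumTo-cong (suc a) (λ i _ → constS-⊛ (f i) (mono i) n)) (terms n)))
  where
  terms : ∀ n → sumTo (λ i → f i ℤ.* mono i n) (suc a) ≡ f n
  terms n with n ≤? a
  ... | yes n≤a = trans (sumTo-single _ (suc a) n (s≤s n≤a)
                           (λ i _ i≢n → trans (cong (f i ℤ.*_) (mono-off i n i≢n)) (ℤₚ.*-zeroʳ (f i))))
                        (trans (cong (f n ℤ.*_) (mono-diag n)) (ℤₚ.*-identityʳ (f n)))
  ... | no n≰a  = trans (sumTo-zero (suc a) λ i i≤a →
                           trans (cong (f i ℤ.*_) (mono-off i n (ℕₚ.<⇒≢ (ℕₚ.≤-<-trans (ℕₚ.≤-pred i≤a)
                                                                          (ℕₚ.≰⇒> n≰a)))))
                                 (ℤₚ.*-zeroʳ (f i)))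
                        (sym (deg n (ℕₚ.≰⇒> n≰a)))

∸-+-distrib : ∀ {a b i j} → i ≤ a → j ≤ b → a + b ∸ (i + j) ≡ (a ∸ i) + (b ∸ j)
∸-+-distrib {a} {b} {i} {j} i≤a j≤b = begin
  a + b ∸ (i + j)                        ≡⟨ cong₂ (λ x y → x + y ∸ (i + j)) (ℕₚ.m+[n∸m]≡n i≤a)
                                                                         (ℕₚ.m+[n∸m]≡n j≤b) ⟨
  i + (a ∸ i) + (j + (b ∸ j)) ∸ (i + j)  ≡⟨ cong (_∸ (i + j)) (ℕ-+-interchange i (a ∸ i) j (b ∸ j)) ⟩
  i + j + ((a ∸ i) + (b ∸ j)) ∸ (i + j)  ≡⟨ ℕₚ.m+n∸m≡n (i + j) _ ⟩
  (a ∸ i) + (b ∸ j)                      ∎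
  where open ≡-Reasoning

reverse-⊛-monomial : ∀ {a b i j} c c′ → i ≤ a → j ≤ b →
  reverse (a + b) (monomial c i ⊛ monomial c′ j) ≈ reverse a (monomial c i) ⊛ reverse b (monomial c′ j)
reverse-⊛-monomial {a} {b} {i} {j} c c′ i≤a j≤b = begin
    reverse (a + b) (monomial c i ⊛ monomial c′ j)
  ≈⟨ reverse-cong (a + b) (monomial-⊛ c c′ i j) ⟩
    reverse (a + b) (monomial (c ℤ.* c′) (i + j))
  ≈⟨ reverse-monomial (c ℤ.* c′) (ℕₚ.+-mono-≤ i≤a j≤b) ⟩
    monomial (c ℤ.* c′) (a + b ∸ (i + j))
  ≡⟨ cong (monomial (c ℤ.* c′)) (∸-+-distrib i≤a j≤b) ⟩
    monomial (c ℤ.* c′) ((a ∸ i) + (b ∸ j))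
  ≈⟨ monomial-⊛ c c′ (a ∸ i) (b ∸ j) ⟨
    monomial c (a ∸ i) ⊛ monomial c′ (b ∸ j)
  ≈⟨ ⊛-cong (reverse-monomial c i≤a) (reverse-monomial c′ j≤b) ⟨
    reverse a (monomial c i) ⊛ reverse b (monomial c′ j)
  ∎
  where open ≈-Reasoning

reverse-⊛ : ∀ a b {f g} → DegreeAtMost a f → DegreeAtMost b g →
            reverse (a + b) (f ⊛ g) ≈ reverse a f ⊛ reverse b g
reverse-⊛ a b {f} {g} deg-f deg-g = begin
    reverse (a + b) (f ⊛ g)
  ≈⟨ reverse-cong (a + b) (≈-trans (⊛-cong (monomial-expansion deg-f) (monomial-expansion deg-g))
                                   (sumS-⊛-sumS u v (suc a) (suc b))) ⟩
    reverse (a + b) (sumS (λ i → sumS (λ j → u i ⊛ v j) (suc b)) (suc a))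
  ≈⟨ reverse-sumS (a + b) _ (suc a) ⟩
    sumS (λ i → reverse (a + b) (sumS (λ j → u i ⊛ v j) (suc b))) (suc a)
  ≈⟨ sumS-cong (suc a) (λ i i≤a → ≈-trans (reverse-sumS (a + b) _ (suc b))
       (sumS-cong (suc b) λ j j≤b → reverse-⊛-monomial (f i) (g j) (ℕₚ.≤-pred i≤a) (ℕₚ.≤-pred j≤b))) ⟩
    sumS (λ i → sumS (λ j → reverse a (u i) ⊛ reverse b (v j)) (suc b)) (suc a)
  ≈⟨ sumS-⊛-sumS (reverse a ∘ u) (reverse b ∘ v) (suc a) (suc b) ⟨
    sumS (reverse a ∘ u) (suc a) ⊛ sumS (reverse b ∘ v) (suc b)
  ≈⟨ ⊛-cong (≈-trans (reverse-cong a (monomial-expansion deg-f)) (reverse-sumS a u (suc a)))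
            (≈-trans (reverse-cong b (monomial-expansion deg-g)) (reverse-sumS b v (suc b))) ⟨
    reverse a f ⊛ reverse b g
  ∎
  where
  open ≈-Reasoning
  u v : ℕ → Series
  u i = monomial (f i) i
  v j = monomial (g j) j

reverse-zero : ∀ {f} → DegreeAtMost 0 f → reverse 0 f ≈ f
reverse-zero {f} deg = pointwise λ where
  zero    → reverse-≤ {0} {f} {0} z≤n
  (suc n) → trans (reverse-> {0} {f} {suc n} (s≤s z≤n)) (sym (deg (suc n) (s≤s z≤n)))

reverse-shift : ∀ d e {f} → DegreeAtMost d f → reverse (d + e) f ≈ mono e ⊛ reverse d f
reverse-shift d e {f} deg = begin
  reverse (d + e) f          ≈⟨ reverse-cong (d + e) (⊛-identityʳ f) ⟨
  reverse (d + e) (f ⊛ one)  ≈⟨ reverse-⊛ d e deg (degree-one e) ⟩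
  reverse d f ⊛ reverse e one ≈⟨ ⊛-congˡ (reverse d f) (reverse-mono z≤n) ⟩
  reverse d f ⊛ mono e       ≈⟨ ⊛-comm (reverse d f) (mono e) ⟩
  mono e ⊛ reverse d f       ∎
  where open ≈-Reasoning

reverse-prodS : ∀ D F n → (∀ j → j < n → DegreeAtMost (D j) (F j)) →
                reverse (sumToℕ D n) (prodS F n) ≈ prodS (λ j → reverse (D j) (F j)) n
reverse-prodS D F zero    deg = reverse-mono {0} z≤n
reverse-prodS D F (suc n) deg = ≈-trans
  (reverse-⊛ (sumToℕ D n) (D n) (degree-prodS D F n deg′) (deg n ℕₚ.≤-refl))
  (⊛-congʳ (reverse (D n) (F n)) (reverse-prodS D F n deg′))
  where
  deg′ : ∀ j → j < n → DegreeAtMost (D j) (F j)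
  deg′ j j<n = deg j (ℕₚ.m<n⇒m<1+n j<n)

reverse-one-minus-mono : ∀ a → reverse a (one ⊖ mono a) ≈ negS (one ⊖ mono a)
reverse-one-minus-mono a = begin
    reverse a (one ⊖ mono a)
  ≈⟨ reverse-⊖ a one (mono a) ⟩
    reverse a one ⊖ reverse a (mono a)
  ≈⟨ ⊕-cong (reverse-mono z≤n) (negS-cong (reverse-mono ℕₚ.≤-refl)) ⟩
    mono a ⊖ mono (a ∸ a)
  ≡⟨ cong (λ e → mono a ⊖ mono e) (ℕₚ.n∸n≡0 a) ⟩
    mono a ⊖ one
  ≈⟨ mono-minus-one a ⟩
    negS (one ⊖ mono a)
  ∎
  where open ≈-Reasoning

reverse-prodS-one-minus : ∀ D n →
  reverse (sumToℕ D n) (prodS (λ j → one ⊖ mono (D j)) n) ≈ signS n ⊛ prodS (λ j → one ⊖ mono (D j)) n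
reverse-prodS-one-minus D n =
  ≈-trans (reverse-prodS D _ n (λ j _ → degree-one-minus-mono (D j)))
    (≈-trans (prodS-cong n (λ j _ → reverse-one-minus-mono (D j)))
             (prodS-negS (λ j → one ⊖ mono (D j)) n))

-- Euler products and Gaussian binomial coefficients

eulerProduct : ℕ → Series
eulerProduct n = prodS (λ j → one ⊖ mono (suc j)) n

-- fallingProduct n i = (q^(n-i+1);q)_i
fallingProduct : ℕ → ℕ → Series
fallingProduct n i = prodS (λ j → one ⊖ mono (n ∸ j)) i

-- The Gaussian binomial coefficient [n choose i], by the q-Pascal rule.
gaussian : ℕ → ℕ → Series
gaussian n       zero    = one
gaussian zero    (suc i) = zeroS
gaussian (suc n) (suc i) = mono (n ∸ i) ⊛ gaussian n i ⊕ gaussian n (suc i)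

fallingProduct-suc : ∀ n i → fallingProduct (suc n) (suc i) ≈ (one ⊖ mono (suc n)) ⊛ fallingProduct n i
fallingProduct-suc n i = prodS-suc (λ j → one ⊖ mono (suc n ∸ j)) i

fallingProduct-self : ∀ n → fallingProduct n n ≈ eulerProduct n
fallingProduct-self n = ≈-trans (prodS-reverse (λ j → one ⊖ mono (n ∸ j)) n)
  (prodS-cong n λ j j<n → ≈-reflexive (cong (λ e → one ⊖ mono e) (ℕₚ.m∸[m∸n]≡n j<n)))

-- For i > n the product contains the factor 1 - q⁰ = 0.
fallingProduct-zero : ∀ n i → n < i → fallingProduct n i ≈ zeroS
fallingProduct-zero n (suc i) n<1+i with n ≟ i
... | yes refl = ≈-trans (⊛-congˡ (fallingProduct n n) vanishing) (⊛-zeroʳ (fallingProduct n n))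
  where
  vanishing : one ⊖ mono (n ∸ n) ≈ zeroS
  vanishing = pointwise λ k → trans (cong (λ e → one k ℤ.+ ℤ.- mono e k) (ℕₚ.n∸n≡0 n))
                                    (ℤₚ.+-inverseʳ (one k))
... | no n≢i = ≈-trans (⊛-congʳ (one ⊖ mono (n ∸ i))
                                (fallingProduct-zero n i (ℕₚ.≤∧≢⇒< (ℕₚ.≤-pred n<1+i) n≢i)))
                       (⊛-zeroˡ (one ⊖ mono (n ∸ i)))

gaussian-zero : ∀ n i → n < i → gaussian n i ≈ zeroS
gaussian-zero zero    (suc i) _             = ≈-refl
gaussian-zero (suc n) (suc i) (s≤s n<i) =
  ≈-trans (⊕-cong (≈-trans (⊛-congˡ (mono (n ∸ i)) (gaussian-zero n i n<i)) (⊛-zeroʳ (mono (n ∸ i))))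
                  (gaussian-zero n (suc i) (ℕₚ.m<n⇒m<1+n n<i)))
          (⊕-identityʳ zeroS)

gaussian-⊛-eulerProduct : ∀ n i → gaussian n i ⊛ eulerProduct i ≈ fallingProduct n i
gaussian-⊛-eulerProduct n       zero    = ⊛-identityˡ one
gaussian-⊛-eulerProduct zero    (suc i) =
  ≈-trans (⊛-zeroˡ (eulerProduct (suc i))) (≈-sym (fallingProduct-zero 0 (suc i) (s≤s z≤n)))
gaussian-⊛-eulerProduct (suc n) (suc i) = begin
    (y ⊛ gaussian n i ⊕ gaussian n (suc i)) ⊛ (eulerProduct i ⊛ z)
  ≈⟨ solve 5 (λ y g h p z → (y :* g :+ h) :* (p :* z) := y :* (g :* p) :* z :+ h :* (p :* z)) ≈-refl
       y (gaussian n i) (gaussian n (suc i)) (eulerProduct i) z ⟩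
    y ⊛ (gaussian n i ⊛ eulerProduct i) ⊛ z ⊕ gaussian n (suc i) ⊛ eulerProduct (suc i)
  ≈⟨ ⊕-cong (⊛-congʳ z (⊛-congˡ y (gaussian-⊛-eulerProduct n i)))
            (gaussian-⊛-eulerProduct n (suc i)) ⟩
    y ⊛ fallingProduct n i ⊛ z ⊕ fallingProduct n i ⊛ (one ⊖ y)
  ≈⟨ solve 3 (λ y Q z → y :* Q :* (con 1ℤ :- z) :+ Q :* (con 1ℤ :- y) := Q :* (con 1ℤ :- y :* z)) ≈-refl
       y (fallingProduct n i) (mono (suc i)) ⟩
    fallingProduct n i ⊛ (one ⊖ y ⊛ mono (suc i))
  ≈⟨ last (i ≤? n) ⟩
    (one ⊖ mono (suc n)) ⊛ fallingProduct n i
  ≈⟨ fallingProduct-suc n i ⟨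
    fallingProduct (suc n) (suc i)
  ∎
  where
  open ≈-Reasoning
  y = mono (n ∸ i)
  z = one ⊖ mono (suc i)
  last : Dec (i ≤ n) → fallingProduct n i ⊛ (one ⊖ y ⊛ mono (suc i))
                     ≈ (one ⊖ mono (suc n)) ⊛ fallingProduct n i
  last (yes i≤n) = ≈-trans
    (⊛-congˡ (fallingProduct n i) (⊕-cong (≈-refl {one}) (negS-cong (≈-trans (mono-+ (n ∸ i) (suc i))
       (≈-reflexive (cong mono (trans (ℕₚ.+-suc (n ∸ i) i) (cong suc (ℕₚ.m∸n+n≡m i≤n)))))))))
    (⊛-comm (fallingProduct n i) (one ⊖ mono (suc n)))
  last (no i≰n) = let Q≈0 = fallingProduct-zero n i (ℕₚ.≰⇒> i≰n) in
    ≈-trans (≈-trans (⊛-congʳ (one ⊖ y ⊛ mono (suc i)) Q≈0) (⊛-zeroˡ (one ⊖ y ⊛ mono (suc i))))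
            (≈-sym (≈-trans (⊛-congˡ (one ⊖ mono (suc n)) Q≈0) (⊛-zeroʳ (one ⊖ mono (suc n)))))

degree-fallingProduct : ∀ n i → DegreeAtMost (sumToℕ (n ∸_) i) (fallingProduct n i)
degree-fallingProduct n i = degree-prodS (n ∸_) _ i (λ j _ → degree-one-minus-mono (n ∸ j))

fallingProduct-≈[]-one : ∀ {N n i} → N + i ≤ suc n → fallingProduct n i ≈[ N ] one
fallingProduct-≈[]-one {N} {n} {i} N+i≤1+n = ≈[]-sym (q^∣-⊖⇒≈[]
  (q^∣-one-minus-prodS N (λ j → one ⊖ mono (n ∸ j)) i λ j j<i →
    q^∣-resp-≈ (solve 1 (λ x → x := con 1ℤ :- (con 1ℤ :- x)) ≈-refl (mono (n ∸ j)))
               (q^∣-weaken (N≤n∸j j<i) (q^∣-mono (n ∸ j)))))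
  where
  N≤n∸j : ∀ {j} → j < i → N ≤ n ∸ j
  N≤n∸j {j} j<i = ℕₚ.m+n≤o⇒m≤o∸n N (ℕₚ.≤-pred (ℕₚ.<-≤-trans (ℕₚ.+-monoʳ-< N j<i) N+i≤1+n))

-- triangle i = i(i+1)/2
triangle : ℕ → ℕ
triangle = sumToℕ suc

qBinomialTerm : ℕ → ℕ → Series
qBinomialTerm n i = signS i ⊛ mono (triangle i) ⊛ gaussian n i

qBinomialTerm-suc : ∀ n i → i ≤ n →
  qBinomialTerm (suc n) (suc i) ≈ negS (mono (suc n) ⊛ qBinomialTerm n i) ⊕ qBinomialTerm n (suc i)
qBinomialTerm-suc n i i≤n = begin
    (negS s ⊛ T) ⊛ (Y ⊛ g ⊕ h)
  ≈⟨ solve 5 (λ s T Y g h → ((:- s) :* T) :* (Y :* g :+ h) := (:- (s :* (T :* Y) :* g)) :+ ((:- s) :* T) :* h)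
       ≈-refl s T Y g h ⟩
    negS (s ⊛ (T ⊛ Y) ⊛ g) ⊕ qBinomialTerm n (suc i)
  ≈⟨ ⊕-cong (negS-cong (⊛-congʳ g (⊛-congˡ s T⊛Y≈X⊛t))) (≈-refl {qBinomialTerm n (suc i)}) ⟩
    negS (s ⊛ (X ⊛ t) ⊛ g) ⊕ qBinomialTerm n (suc i)
  ≈⟨ ⊕-cong (negS-cong (solve 4 (λ s X t g → s :* (X :* t) :* g := X :* ((s :* t) :* g)) ≈-refl s X t g))
            (≈-refl {qBinomialTerm n (suc i)}) ⟩
    negS (mono (suc n) ⊛ qBinomialTerm n i) ⊕ qBinomialTerm n (suc i)
  ∎
  where
  open ≈-Reasoning
  s = signS i
  T = mono (triangle i + suc i)
  Y = mono (n ∸ i)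
  g = gaussian n i
  h = gaussian n (suc i)
  X = mono (suc n)
  t = mono (triangle i)
  exponent : triangle i + suc i + (n ∸ i) ≡ suc n + triangle i
  exponent = trans (ℕₚ.+-assoc (triangle i) (suc i) (n ∸ i))
    (trans (cong (λ e → triangle i + suc e) (ℕₚ.m+[n∸m]≡n i≤n)) (ℕₚ.+-comm (triangle i) (suc n)))
  T⊛Y≈X⊛t : T ⊛ Y ≈ X ⊛ t
  T⊛Y≈X⊛t = ≈-trans (mono-+ (triangle i + suc i) (n ∸ i))
    (≈-trans (≈-reflexive (cong mono exponent)) (≈-sym (mono-+ (suc n) (triangle i))))

q-binomial : ∀ n → eulerProduct n ≈ sumS (qBinomialTerm n) (suc n)
q-binomial zero    = ≈-sym (solve 0 (con 0ℤ :+ (con 1ℤ :* con 1ℤ) :* con 1ℤ := con 1ℤ) ≈-refl)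
q-binomial (suc n) = ≈-sym (begin
    sumS (qBinomialTerm (suc n)) (suc (suc n))
  ≈⟨ sumS-suc (qBinomialTerm (suc n)) (suc n) ⟩
    qBinomialTerm n 0 ⊕ sumS (λ i → qBinomialTerm (suc n) (suc i)) (suc n)
  ≈⟨ ⊕-cong (≈-refl {qBinomialTerm n 0})
       (≈-trans (sumS-cong (suc n) (λ i i≤n → qBinomialTerm-suc n i (ℕₚ.≤-pred i≤n)))
       (≈-trans (sumS-⊕ (λ i → negS (X ⊛ qBinomialTerm n i)) (λ i → qBinomialTerm n (suc i)) (suc n))
                (⊕-cong (≈-trans (sumS-negS (λ i → X ⊛ qBinomialTerm n i) (suc n))
                                 (negS-cong (≈-sym (⊛-sumS X (qBinomialTerm n) (suc n)))))
                        (≈-refl {S′})))) ⟩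
    qBinomialTerm n 0 ⊕ (negS (X ⊛ S) ⊕ S′)
  ≈⟨ solve 4 (λ b X S S′ → b :+ ((:- (X :* S)) :+ S′) := (:- (X :* S)) :+ (b :+ S′)) ≈-refl
       (qBinomialTerm n 0) X S S′ ⟩
    negS (X ⊛ S) ⊕ (qBinomialTerm n 0 ⊕ S′)
  ≈⟨ ⊕-cong (≈-refl {negS (X ⊛ S)}) (sumS-suc (qBinomialTerm n) (suc n)) ⟨
    negS (X ⊛ S) ⊕ (S ⊕ qBinomialTerm n (suc n))
  ≈⟨ ⊕-cong (≈-refl {negS (X ⊛ S)}) (≈-trans (⊕-cong (≈-refl {S}) last-vanishes) (⊕-identityʳ S)) ⟩
    negS (X ⊛ S) ⊕ S
  ≈⟨ solve 2 (λ X S → (:- (X :* S)) :+ S := S :* (con 1ℤ :- X)) ≈-refl X S ⟩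
    S ⊛ (one ⊖ X)
  ≈⟨ ⊛-congʳ (one ⊖ X) (q-binomial n) ⟨
    eulerProduct (suc n)
  ∎)
  where
  open ≈-Reasoning
  X = mono (suc n)
  S = sumS (qBinomialTerm n) (suc n)
  S′ = sumS (λ i → qBinomialTerm n (suc i)) (suc n)
  last-vanishes : qBinomialTerm n (suc n) ≈ zeroS
  last-vanishes = ≈-trans (⊛-congˡ (signS (suc n) ⊛ mono (triangle (suc n)))
                                   (gaussian-zero n (suc n) ℕₚ.≤-refl))
                          (⊛-zeroʳ (signS (suc n) ⊛ mono (triangle (suc n))))

eulerProduct-split : ∀ i k → eulerProduct (i + k) ≈ eulerProduct i ⊛ fallingProduct (i + k) k
eulerProduct-split i zero    rewrite ℕₚ.+-identityʳ i = ≈-sym (⊛-identityʳ (eulerProduct i))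
eulerProduct-split i (suc k) rewrite ℕₚ.+-suc i k = begin
    eulerProduct (i + k) ⊛ z
  ≈⟨ ⊛-congʳ z (eulerProduct-split i k) ⟩
    eulerProduct i ⊛ fallingProduct (i + k) k ⊛ z
  ≈⟨ solve 3 (λ p Q z → p :* Q :* z := p :* (z :* Q)) ≈-refl (eulerProduct i) (fallingProduct (i + k) k) z ⟩
    eulerProduct i ⊛ (z ⊛ fallingProduct (i + k) k)
  ≈⟨ ⊛-congˡ (eulerProduct i) (fallingProduct-suc (i + k) k) ⟨
    eulerProduct i ⊛ fallingProduct (suc (i + k)) (suc k)
  ∎
  where
  open ≈-Reasoning
  z = one ⊖ mono (suc (i + k))

eulerProduct-split′ : ∀ {i m} → i ≤ m → eulerProduct m ≈ eulerProduct i ⊛ fallingProduct m (m ∸ i)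
eulerProduct-split′ {i} {m} i≤m =
  subst (λ n → eulerProduct n ≈ eulerProduct i ⊛ fallingProduct n (m ∸ i)) (ℕₚ.m+[n∸m]≡n i≤m)
        (eulerProduct-split i (m ∸ i))

degree-gaussian : ∀ n i → DegreeAtMost (i * (n ∸ i)) (gaussian n i)
degree-gaussian n       zero    = degree-mono 0
degree-gaussian zero    (suc i) _ _ = refl
degree-gaussian (suc n) (suc i) = degree-⊕
  (degree-⊛ (degree-mono (n ∸ i)) (degree-gaussian n i))
  (degree-weaken (ℕₚ.*-monoʳ-≤ (suc i) (ℕₚ.∸-monoʳ-≤ n (ℕₚ.n≤1+n i))) (degree-gaussian n (suc i)))

eulerProduct-constant : ∀ m → eulerProduct m 0 ≡ 1ℤ
eulerProduct-constant zero    = refl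
eulerProduct-constant (suc m) = trans (ℤₚ.+-identityˡ _) (cong (ℤ._* 1ℤ) (eulerProduct-constant m))

eulerProduct-truncate : ∀ {h m} → h ≤ m → eulerProduct m ≈[ suc h ] eulerProduct h
eulerProduct-truncate {h} {m} h≤m =
  subst (λ n → eulerProduct n ≈[ suc h ] eulerProduct h) (ℕₚ.m+[n∸m]≡n h≤m) (truncate (m ∸ h))
  where
  truncate : ∀ k → eulerProduct (h + k) ≈[ suc h ] eulerProduct h
  truncate zero    rewrite ℕₚ.+-identityʳ h = below λ _ _ → refl
  truncate (suc k) rewrite ℕₚ.+-suc h k =
    ≈[]-trans (≈[]-⊛ (truncate k) (one-minus-mono-≈[] (s≤s (ℕₚ.m≤m+n h k))))
              (≈⇒≈[] (suc h) (⊛-identityʳ (eulerProduct h)))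

-- The coefficients of ∏ (1 - q^i)^(k-1)

geomS-extend : ∀ a n K → suc n ≤ K → sumTo (λ t → mono (suc a * t) n) K ≡ geomS (suc a) n
geomS-extend a n K 1+n≤K = begin
    sumTo F K
  ≡⟨ cong (sumTo F) (ℕₚ.m+[n∸m]≡n 1+n≤K) ⟨
    sumTo F (suc n + (K ∸ suc n))
  ≡⟨ sumTo-split F (suc n) (K ∸ suc n) ⟩
    geomS (suc a) n ℤ.+ sumTo (λ t → F (suc n + t)) (K ∸ suc n)
  ≡⟨ cong (λ s → geomS (suc a) n ℤ.+ s) (sumTo-zero (K ∸ suc n) λ t _ →
       mono-off (suc a * (suc n + t)) n (ℕₚ.>⇒≢ (ℕₚ.<-≤-trans (ℕₚ.m≤m+n (suc n) t)
                                                  (ℕₚ.m≤n*m (suc n + t) (suc a))))) ⟩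
    geomS (suc a) n ℤ.+ 0ℤ
  ≡⟨ ℤₚ.+-identityʳ _ ⟩
    geomS (suc a) n
  ∎
  where
  open ≡-Reasoning
  F = λ t → mono (suc a * t) n

mono-shift : ∀ i a n → i ≤ n → mono (i + a) n ≡ mono a (n ∸ i)
mono-shift i a n i≤n = trans (sym (at (mono-+ i a) n)) (mono-⊛-≥ i (mono a) n i≤n)

geomS-step : ∀ a n → suc a ≤ n → geomS (suc a) n ≡ geomS (suc a) (n ∸ suc a)
geomS-step a n a<n = begin
    geomS (suc a) n
  ≡⟨ sumTo-suc (λ t → mono (suc a * t) n) n ⟩
    mono (suc a * 0) n ℤ.+ sumTo (λ t → mono (suc a * suc t) n) n
  ≡⟨ cong₂ ℤ._+_ (trans (cong (λ e → mono e n) (ℕₚ.*-zeroʳ (suc a))) (mono-off 0 n (ℕₚ.<⇒≢ 0<n)))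
                 (sumTo-cong n λ t _ → trans (cong (λ e → mono e n) (ℕₚ.*-suc (suc a) t))
                                             (mono-shift (suc a) (suc a * t) n a<n)) ⟩
    0ℤ ℤ.+ sumTo (λ t → mono (suc a * t) (n ∸ suc a)) n
  ≡⟨ ℤₚ.+-identityˡ _ ⟩
    sumTo (λ t → mono (suc a * t) (n ∸ suc a)) n
  ≡⟨ geomS-extend a (n ∸ suc a) n (ℕₚ.∸-monoʳ-< {n} {suc a} {0} (s≤s z≤n) a<n) ⟩
    geomS (suc a) (n ∸ suc a)
  ∎
  where
  open ≡-Reasoning
  0<n = ℕₚ.<-≤-trans (s≤s z≤n) a<n

geomS-below : ∀ a n → n < suc a → geomS (suc a) n ≡ one n
geomS-below a n n<1+a =
  trans (sumTo-suc (λ t → mono (suc a * t) n) n)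
    (trans (cong₂ ℤ._+_ (cong (λ e → mono e n) (ℕₚ.*-zeroʳ (suc a)))
                        (sumTo-zero n λ t _ → mono-off (suc a * suc t) n
                           (ℕₚ.>⇒≢ (ℕₚ.<-≤-trans n<1+a (ℕₚ.m≤m*n (suc a) (suc t))))))
           (ℤₚ.+-identityʳ (one n)))

geomS-inverse : ∀ a → geomS (suc a) ⊛ (one ⊖ mono (suc a)) ≈ one
geomS-inverse a = ≈-trans (solve 2 (λ g x → g :* (con 1ℤ :- x) := g :- x :* g) ≈-refl g x)
                          (pointwise coefficient)
  where
  g = geomS (suc a)
  x = mono (suc a)
  coefficient : ∀ n → (g ⊖ x ⊛ g) n ≡ one n
  coefficient n with suc a ≤? n
  ... | yes a<n = trans (cong₂ (λ u v → u ℤ.+ ℤ.- v) (geomS-step a n a<n) (mono-⊛-≥ (suc a) g n a<n))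
                        (trans (ℤₚ.+-inverseʳ (g (n ∸ suc a)))
                               (sym (mono-off 0 n (ℕₚ.<⇒≢ (ℕₚ.<-≤-trans (s≤s z≤n) a<n)))))
  ... | no a≮n = trans (cong₂ (λ u v → u ℤ.+ ℤ.- v) (geomS-below a n (ℕₚ.≰⇒> a≮n))
                                                    (mono-⊛-< (suc a) g n (ℕₚ.≰⇒> a≮n)))
                       (ℤₚ.+-identityʳ (one n))

eulerInverse : ℕ → Series
eulerInverse h = prodS (λ j → geomS (suc j)) h

eulerInverse-⊛-eulerProduct : ∀ h → eulerInverse h ⊛ eulerProduct h ≈ one
eulerInverse-⊛-eulerProduct h =
  ≈-trans (≈-sym (prodS-⊛ (λ j → geomS (suc j)) (λ j → one ⊖ mono (suc j)) h))
          (≈-trans (prodS-cong h (λ j _ → geomS-inverse j)) (prodS-one h))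

eulerCoeff-1 : ∀ h → eulerCoeff 1 h ≡ one h
eulerCoeff-1 h = at (prodS-one h) h

eulerCoeff-2 : ∀ h → eulerCoeff 2 h ≡ eulerProduct h h
eulerCoeff-2 h = at (prodS-cong h (λ j _ → ⊛-identityˡ (one ⊖ mono (suc j)))) h

eulerCoeff-3 : ∀ h → eulerCoeff 3 h ≡ (eulerProduct h ⊛ eulerProduct h) h
eulerCoeff-3 h = at (≈-trans
  (prodS-cong h λ j _ → ⊛-congʳ (one ⊖ mono (suc j)) (⊛-identityˡ (one ⊖ mono (suc j))))
  (prodS-⊛ (λ j → one ⊖ mono (suc j)) (λ j → one ⊖ mono (suc j)) h)) h

-- Exponent arithmetic

sumToℕ-cong : ∀ {D E} n → (∀ j → j < n → D j ≡ E j) → sumToℕ D n ≡ sumToℕ E n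
sumToℕ-cong zero    eq = refl
sumToℕ-cong (suc n) eq = cong₂ _+_ (sumToℕ-cong n (λ j j<n → eq j (ℕₚ.m<n⇒m<1+n j<n))) (eq n ℕₚ.≤-refl)

sumToℕ-+ : ∀ D E n → sumToℕ (λ j → D j + E j) n ≡ sumToℕ D n + sumToℕ E n
sumToℕ-+ D E zero    = refl
sumToℕ-+ D E (suc n) =
  trans (cong (_+ (D n + E n)) (sumToℕ-+ D E n)) (ℕ-+-interchange (sumToℕ D n) (sumToℕ E n) (D n) (E n))

sumToℕ-const : ∀ c n → sumToℕ (λ _ → c) n ≡ n * c
sumToℕ-const c zero    = refl
sumToℕ-const c (suc n) = trans (cong (_+ c) (sumToℕ-const c n)) (ℕₚ.+-comm (n * c) c)

sumToℕ-split : ∀ D m n → sumToℕ D (m + n) ≡ sumToℕ D m + sumToℕ (λ j → D (m + j)) n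
sumToℕ-split D m zero    rewrite ℕₚ.+-identityʳ m = sym (ℕₚ.+-identityʳ (sumToℕ D m))
sumToℕ-split D m (suc n) rewrite ℕₚ.+-suc m n | sumToℕ-split D m n =
  ℕₚ.+-assoc (sumToℕ D m) _ (D (m + n))

sumToℕ-reverse : ∀ D n → sumToℕ D n ≡ sumToℕ (λ j → D (n ∸ suc j)) n
sumToℕ-reverse D zero    = refl
sumToℕ-reverse D (suc n) = begin
  sumToℕ D n + D n                                   ≡⟨ cong (_+ D n) (sumToℕ-reverse D n) ⟩
  sumToℕ (λ j → D (n ∸ suc j)) n + D n               ≡⟨ ℕₚ.+-comm _ (D n) ⟩
  D n + sumToℕ (λ j → D (n ∸ suc j)) n               ≡⟨ sumToℕ-split (λ j → D (suc n ∸ suc j)) 1 n ⟨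
  sumToℕ (λ j → D (suc n ∸ suc j)) (suc n)           ∎
  where open ≡-Reasoning

sumToℕ-countdown : ∀ n → sumToℕ (n ∸_) n ≡ triangle n
sumToℕ-countdown n = trans (sumToℕ-reverse (n ∸_) n) (sumToℕ-cong n λ j j<n → ℕₚ.m∸[m∸n]≡n j<n)

sumToℕ-countdown-split : ∀ {i m} → i ≤ m → sumToℕ (m ∸_) m ≡ sumToℕ (m ∸_) (m ∸ i) + triangle i
sumToℕ-countdown-split {i} {m} i≤m = begin
    sumToℕ (m ∸_) m
  ≡⟨ cong (sumToℕ (m ∸_)) (ℕₚ.m+[n∸m]≡n (ℕₚ.m∸n≤m m i)) ⟨
    sumToℕ (m ∸_) ((m ∸ i) + (m ∸ (m ∸ i)))
  ≡⟨ cong (λ k → sumToℕ (m ∸_) ((m ∸ i) + k)) (ℕₚ.m∸[m∸n]≡n i≤m) ⟩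
    sumToℕ (m ∸_) ((m ∸ i) + i)
  ≡⟨ sumToℕ-split (m ∸_) (m ∸ i) i ⟩
    sumToℕ (m ∸_) (m ∸ i) + sumToℕ (λ j → m ∸ (m ∸ i + j)) i
  ≡⟨ cong (sumToℕ (m ∸_) (m ∸ i) +_) (trans (sumToℕ-cong i λ j _ →
       trans (sym (ℕₚ.∸-+-assoc m (m ∸ i) j)) (cong (_∸ j) (ℕₚ.m∸[m∸n]≡n i≤m)))
       (sumToℕ-countdown i)) ⟩
    sumToℕ (m ∸_) (m ∸ i) + triangle i
  ∎
  where open ≡-Reasoning

-- The exponent m(m-1)/2 of C_{m,3}, plus the degree of its sum, is m².
C3-exponents : ∀ m → (m * (m ∸ 1)) / 2 + sumToℕ (m ∸_) m ≡ m * m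
C3-exponents m = begin
  (m * (m ∸ 1)) / 2 + sumToℕ (m ∸_) m  ≡⟨ cong₂ _+_ (cong (_/ 2) (sym (doubled m))) (sumToℕ-countdown m) ⟩
  (S m * 2) / 2 + triangle m           ≡⟨ cong (_+ triangle m) (m*n/n≡m (S m) 2) ⟩
  S m + triangle m                     ≡⟨ squared m ⟩
  m * m                                ∎
  where
  open ≡-Reasoning
  S : ℕ → ℕ
  S = sumToℕ (λ j → j)
  doubled : ∀ m → S m * 2 ≡ m * (m ∸ 1)
  doubled zero          = refl
  doubled (suc zero)    = refl
  doubled (suc (suc m)) = trans (ℕₚ.*-distribʳ-+ 2 (S (suc m)) (suc m))
    (trans (cong (_+ suc m * 2) (doubled (suc m))) (step m))
    where
    step : ∀ m → suc m * m + suc m * 2 ≡ suc (suc m) * suc m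
    step = solve-∀
  squared : ∀ m → S m + triangle m ≡ m * m
  squared zero    = refl
  squared (suc m) = trans (ℕ-+-interchange (S m) m (triangle m) (suc m))
    (trans (cong (_+ (m + suc m)) (squared m)) (step m))
    where
    step : ∀ m → m * m + (m + suc m) ≡ suc m * suc m
    step = solve-∀

≤-triangle : ∀ i → i ≤ triangle i
≤-triangle zero    = z≤n
≤-triangle (suc i) = ℕₚ.m≤n+m (suc i) (triangle i)

2m∸j : ∀ {m j} → j ≤ m → 2 * m ∸ j ≡ m + (m ∸ j)
2m∸j {m} {j} j≤m = trans (cong (_∸ j) (cong (m +_) (ℕₚ.+-identityʳ m))) (ℕₚ.+-∸-assoc m j≤m)

C0-exponent : ∀ m → m * m + triangle m ≡ sumToℕ (2 * m ∸_) m
C0-exponent m = sym (begin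
  sumToℕ (2 * m ∸_) m                   ≡⟨ sumToℕ-cong m (λ j j<m → 2m∸j (ℕₚ.<⇒≤ j<m)) ⟩
  sumToℕ (λ j → m + (m ∸ j)) m          ≡⟨ sumToℕ-+ (λ _ → m) (m ∸_) m ⟩
  sumToℕ (λ _ → m) m + sumToℕ (m ∸_) m  ≡⟨ cong₂ _+_ (sumToℕ-const m m) (sumToℕ-countdown m) ⟩
  m * m + triangle m                    ∎)
  where open ≡-Reasoning

≤-square : ∀ {h m} → h ≤ m → h ≤ m * m
≤-square {m = zero}  z≤n  = z≤n
≤-square {m = suc m} h≤m = ℕₚ.≤-trans h≤m (ℕₚ.m≤m*n (suc m) (suc m))

-- Top coefficients of C_{m,k}

C1-top-coefficient : ∀ {m h} → h ≤ m → C1 m (m * m ∸ h) ≡ eulerCoeff 1 h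
C1-top-coefficient {m} {h} h≤m = begin
  C1 m (m * m ∸ h)                    ≡⟨ reverse-≤ (≤-square h≤m) ⟨
  reverse (m * m) (mono (m * m)) h    ≡⟨ at (reverse-mono ℕₚ.≤-refl) h ⟩
  mono (m * m ∸ m * m) h              ≡⟨ cong (λ d → mono d h) (ℕₚ.n∸n≡0 (m * m)) ⟩
  one h                               ≡⟨ eulerCoeff-1 h ⟨
  eulerCoeff 1 h                      ∎
  where open ≡-Reasoning

reverse-mono-minus-mono : ∀ {m j} → j ≤ m → reverse m (mono m ⊖ mono j) ≈ one ⊖ mono (m ∸ j)
reverse-mono-minus-mono {m} {j} j≤m = begin
    reverse m (mono m ⊖ mono j)
  ≈⟨ reverse-⊖ m (mono m) (mono j) ⟩
    reverse m (mono m) ⊖ reverse m (mono j)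
  ≈⟨ ⊕-cong (reverse-mono ℕₚ.≤-refl) (negS-cong (reverse-mono j≤m)) ⟩
    mono (m ∸ m) ⊖ mono (m ∸ j)
  ≡⟨ cong (λ e → mono e ⊖ mono (m ∸ j)) (ℕₚ.n∸n≡0 m) ⟩
    one ⊖ mono (m ∸ j)
  ∎
  where open ≈-Reasoning

reverse-C2 : ∀ m → reverse (m * m) (C2 m) ≈ eulerProduct m
reverse-C2 m = begin
    reverse (m * m) (C2 m)
  ≡⟨ cong (λ d → reverse d (C2 m)) (sumToℕ-const m m) ⟨
    reverse (sumToℕ (λ _ → m) m) (C2 m)
  ≈⟨ reverse-prodS (λ _ → m) (λ j → mono m ⊖ mono j) m (λ j j<m →
       degree-⊕ (degree-mono m) (degree-negS (degree-weaken (ℕₚ.<⇒≤ j<m) (degree-mono j)))) ⟩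
    prodS (λ j → reverse m (mono m ⊖ mono j)) m
  ≈⟨ prodS-cong m (λ j j<m → reverse-mono-minus-mono (ℕₚ.<⇒≤ j<m)) ⟩
    fallingProduct m m
  ≈⟨ fallingProduct-self m ⟩
    eulerProduct m
  ∎
  where open ≈-Reasoning

C2-top-coefficient : ∀ {m h} → h ≤ m → C2 m (m * m ∸ h) ≡ eulerCoeff 2 h
C2-top-coefficient {m} {h} h≤m = begin
  C2 m (m * m ∸ h)          ≡⟨ reverse-≤ (≤-square h≤m) ⟨
  reverse (m * m) (C2 m) h  ≡⟨ at (reverse-C2 m) h ⟩
  eulerProduct m h          ≡⟨ at< (eulerProduct-truncate h≤m) h ℕₚ.≤-refl ⟩
  eulerProduct h h          ≡⟨ eulerCoeff-2 h ⟨
  eulerCoeff 2 h            ∎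
  where open ≡-Reasoning

C0-equation : ∀ {m C} → IsC m 0 C → C ⊛ eulerProduct m ≈ fallingProduct (2 * m) m
C0-equation {m} {C} isC = cancel-signS m C (eulerProduct m) (fallingProduct (2 * m) m) (begin
  C ⊛ (signS m ⊛ eulerProduct m)      ≈⟨ ⊛-congˡ C (prodS-mono-minus-one suc m) ⟨
  C ⊛ C0den m                         ≈⟨ pointwise isC ⟩
  C0num m                             ≈⟨ prodS-mono-minus-one (2 * m ∸_) m ⟩
  signS m ⊛ fallingProduct (2 * m) m  ∎)
  where open ≈-Reasoning

-- The quotient is the Gaussian binomial [2m choose m], so it has degree m², and reversing
-- the equation multiplies both products by the same sign (-1)^m.
reverse-C0-equation : ∀ {m C} → C ⊛ eulerProduct m ≈ fallingProduct (2 * m) m →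
                      reverse (m * m) C ⊛ eulerProduct m ≈ fallingProduct (2 * m) m
reverse-C0-equation {m} {C} eq = cancel-signS m R (eulerProduct m) Q (begin
    R ⊛ (signS m ⊛ eulerProduct m)
  ≈⟨ ⊛-congˡ R (reverse-prodS-one-minus suc m) ⟨
    R ⊛ reverse (triangle m) (eulerProduct m)
  ≈⟨ reverse-⊛ (m * m) (triangle m) degree-C
       (degree-prodS suc _ m (λ j _ → degree-one-minus-mono (suc j))) ⟨
    reverse (m * m + triangle m) (C ⊛ eulerProduct m)
  ≈⟨ reverse-cong (m * m + triangle m) eq ⟩
    reverse (m * m + triangle m) Q
  ≡⟨ cong (λ d → reverse d Q) (C0-exponent m) ⟩
    reverse (sumToℕ (2 * m ∸_) m) Q
  ≈⟨ reverse-prodS-one-minus (2 * m ∸_) m ⟩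
    signS m ⊛ Q
  ∎)
  where
  open ≈-Reasoning
  R = reverse (m * m) C
  Q = fallingProduct (2 * m) m
  C≈gaussian : C ≈ gaussian (2 * m) m
  C≈gaussian = ⊛-cancelʳ {D = eulerProduct m} (eulerProduct-constant m)
                         (≈-trans eq (≈-sym (gaussian-⊛-eulerProduct (2 * m) m)))
  degree-C : DegreeAtMost (m * m) C
  degree-C = degree-resp-≈ {m * m} (≈-sym C≈gaussian)
    (subst (λ d → DegreeAtMost d (gaussian (2 * m) m))
           (cong (m *_) (trans (2m∸j {m} ℕₚ.≤-refl) (trans (cong (m +_) (ℕₚ.n∸n≡0 m)) (ℕₚ.+-identityʳ m))))
           (degree-gaussian (2 * m) m))

C0-top-coefficient : ∀ {m h C} → IsC m 0 C → h ≤ m → C (m * m ∸ h) ≡ eulerCoeff 0 h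
C0-top-coefficient {m} {h} {C} isC h≤m = begin
  C (m * m ∸ h)     ≡⟨ reverse-≤ (≤-square h≤m) ⟨
  R h               ≡⟨ at< (⊛-cancelʳ-≈[] {R} {eulerInverse h} {eulerProduct h} (suc h)
                              (eulerProduct-constant h) R⊛P≈E⊛P) h ℕₚ.≤-refl ⟩
  eulerInverse h h  ∎
  where
  open ≡-Reasoning
  R = reverse (m * m) C
  Q≈1 : fallingProduct (2 * m) m ≈[ suc m ] one
  Q≈1 = fallingProduct-≈[]-one (ℕₚ.≤-reflexive (cong suc (sym (2m∸j {m} z≤n))))
  R⊛P≈E⊛P : R ⊛ eulerProduct h ≈[ suc h ] eulerInverse h ⊛ eulerProduct h
  R⊛P≈E⊛P = ≈[]-trans (≈[]-⊛ (≈[]-refl {R}) (≈[]-sym (eulerProduct-truncate h≤m)))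
            (≈[]-trans (≈⇒≈[] (suc h) (reverse-C0-equation {m} {C} (C0-equation {m} {C} isC)))
            (≈[]-trans (≈[]-weaken (s≤s h≤m) Q≈1)
                       (≈⇒≈[] (suc h) (≈-sym (eulerInverse-⊛-eulerProduct h)))))

-- The i-th summand of the reciprocal of C_{m,3}.
reversedC3Term : ℕ → ℕ → Series
reversedC3Term m i = signS i ⊛ mono (triangle i) ⊛ fallingProduct m (m ∸ i)

reverse-fallingProduct : ∀ {i m} → i ≤ m →
  reverse (sumToℕ (m ∸_) m) (fallingProduct m (m ∸ i))
    ≈ mono (triangle i) ⊛ (signS (m ∸ i) ⊛ fallingProduct m (m ∸ i))
reverse-fallingProduct {i} {m} i≤m = begin
    reverse (sumToℕ (m ∸_) m) Q
  ≡⟨ cong (λ d → reverse d Q) (sumToℕ-countdown-split i≤m) ⟩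
    reverse (sumToℕ (m ∸_) (m ∸ i) + triangle i) Q
  ≈⟨ reverse-shift (sumToℕ (m ∸_) (m ∸ i)) (triangle i) (degree-fallingProduct m (m ∸ i)) ⟩
    mono (triangle i) ⊛ reverse (sumToℕ (m ∸_) (m ∸ i)) Q
  ≈⟨ ⊛-congˡ (mono (triangle i)) (reverse-prodS-one-minus (m ∸_) (m ∸ i)) ⟩
    mono (triangle i) ⊛ (signS (m ∸ i) ⊛ Q)
  ∎
  where
  open ≈-Reasoning
  Q = fallingProduct m (m ∸ i)

reverse-signS-mono : ∀ m s → reverse s (signS m ⊛ mono s) ≈ signS m
reverse-signS-mono m s = begin
  reverse s (signS m ⊛ mono s)             ≈⟨ reverse-⊛ 0 s (degree-signS m) (degree-mono s) ⟩
  reverse 0 (signS m) ⊛ reverse s (mono s) ≈⟨ ⊛-cong (reverse-zero (degree-signS m))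
                                                      (reverse-mono ℕₚ.≤-refl) ⟩
  signS m ⊛ mono (s ∸ s)                   ≡⟨ cong (λ e → signS m ⊛ mono e) (ℕₚ.n∸n≡0 s) ⟩
  signS m ⊛ one                            ≈⟨ ⊛-identityʳ (signS m) ⟩
  signS m                                  ∎
  where open ≈-Reasoning

signS-⊛-reverse-fallingProduct : ∀ {i m} → i ≤ m →
  signS m ⊛ reverse (sumToℕ (m ∸_) m) (fallingProduct m (m ∸ i)) ≈ reversedC3Term m i
signS-⊛-reverse-fallingProduct {i} {m} i≤m = begin
    signS m ⊛ reverse (sumToℕ (m ∸_) m) Q
  ≈⟨ ⊛-cong signS-split (reverse-fallingProduct i≤m) ⟩
    (signS i ⊛ signS (m ∸ i)) ⊛ (mono (triangle i) ⊛ (signS (m ∸ i) ⊛ Q))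
  ≈⟨ solve 4 (λ a b t q → (a :* b) :* (t :* (b :* q)) := (a :* t :* q) :* (b :* b)) ≈-refl
       (signS i) (signS (m ∸ i)) (mono (triangle i)) Q ⟩
    reversedC3Term m i ⊛ (signS (m ∸ i) ⊛ signS (m ∸ i))
  ≈⟨ ⊛-congˡ (reversedC3Term m i) (signS-square (m ∸ i)) ⟩
    reversedC3Term m i ⊛ one
  ≈⟨ ⊛-identityʳ (reversedC3Term m i) ⟩
    reversedC3Term m i
  ∎
  where
  open ≈-Reasoning
  Q = fallingProduct m (m ∸ i)
  signS-split : signS m ≈ signS i ⊛ signS (m ∸ i)
  signS-split = ≈-trans (≈-reflexive (cong signS (sym (ℕₚ.m+[n∸m]≡n i≤m)))) (signS-+ i (m ∸ i))

reverse-C3 : ∀ m → reverse (m * m) (C3 m) ≈ sumS (reversedC3Term m) (suc m)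
reverse-C3 m = begin
    reverse (m * m) (C3 m)
  ≡⟨ cong (λ d → reverse d (C3 m)) (C3-exponents m) ⟨
    reverse (s + T) (signS m ⊛ mono s ⊛ Σ)
  ≈⟨ reverse-⊛ s T (degree-⊛ {0} (degree-signS m) (degree-mono s)) degree-Σ ⟩
    reverse s (signS m ⊛ mono s) ⊛ reverse T Σ
  ≈⟨ ⊛-cong (reverse-signS-mono m s) (reverse-sumS T Q (suc m)) ⟩
    signS m ⊛ sumS (λ i → reverse T (Q i)) (suc m)
  ≈⟨ ⊛-sumS (signS m) (λ i → reverse T (Q i)) (suc m) ⟩
    sumS (λ i → signS m ⊛ reverse T (Q i)) (suc m)
  ≈⟨ sumS-cong (suc m) (λ i i≤m → signS-⊛-reverse-fallingProduct (ℕₚ.≤-pred i≤m)) ⟩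
    sumS (reversedC3Term m) (suc m)
  ∎
  where
  open ≈-Reasoning
  s = (m * (m ∸ 1)) / 2
  T = sumToℕ (m ∸_) m
  Q : ℕ → Series
  Q i = fallingProduct m (m ∸ i)
  Σ = sumS Q (suc m)
  degree-Σ : DegreeAtMost T Σ
  degree-Σ = degree-sumS T Q (suc m) λ i i≤m →
    degree-weaken (subst (sumToℕ (m ∸_) (m ∸ i) ≤_) (sym (sumToℕ-countdown-split (ℕₚ.≤-pred i≤m)))
                         (ℕₚ.m≤m+n _ (triangle i)))
                  (degree-fallingProduct m (m ∸ i))

eulerProduct-⊛-qBinomialTerm : ∀ {m i} → i ≤ m →
  eulerProduct m ⊛ qBinomialTerm m i ≈ reversedC3Term m i ⊛ fallingProduct m i
eulerProduct-⊛-qBinomialTerm {m} {i} i≤m = begin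
    eulerProduct m ⊛ (c ⊛ gaussian m i)
  ≈⟨ solve 3 (λ p c g → p :* (c :* g) := c :* (g :* p)) ≈-refl (eulerProduct m) c (gaussian m i) ⟩
    c ⊛ (gaussian m i ⊛ eulerProduct m)
  ≈⟨ ⊛-congˡ c (⊛-congˡ (gaussian m i) (eulerProduct-split′ i≤m)) ⟩
    c ⊛ (gaussian m i ⊛ (eulerProduct i ⊛ Q′))
  ≈⟨ ⊛-congˡ c (≈-trans (≈-sym (⊛-assoc (gaussian m i) (eulerProduct i) Q′))
                        (⊛-congʳ Q′ (gaussian-⊛-eulerProduct m i))) ⟩
    c ⊛ (fallingProduct m i ⊛ Q′)
  ≈⟨ solve 3 (λ c x y → c :* (x :* y) := (c :* y) :* x) ≈-refl c (fallingProduct m i) Q′ ⟩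
    reversedC3Term m i ⊛ fallingProduct m i
  ∎
  where
  open ≈-Reasoning
  c = signS i ⊛ mono (triangle i)
  Q′ = fallingProduct m (m ∸ i)

reversedC3Term-≈[] : ∀ {m i} → i ≤ m →
  reversedC3Term m i ⊛ fallingProduct m i ≈[ suc m ] reversedC3Term m i
reversedC3Term-≈[] {m} {i} i≤m = ≈[]-weaken bound
  (⊛-≈[]-one {triangle i} {suc (m ∸ i)}
     (q^∣-⊛ˡ (fallingProduct m (m ∸ i)) (q^∣-⊛ʳ (signS i) (q^∣-mono (triangle i))))
     (fallingProduct-≈[]-one (ℕₚ.≤-reflexive (cong suc (ℕₚ.m∸n+n≡m i≤m)))))
  where
  bound : suc m ≤ triangle i + suc (m ∸ i)
  bound = subst (_≤ triangle i + suc (m ∸ i)) (trans (ℕₚ.+-suc i (m ∸ i)) (cong suc (ℕₚ.m+[n∸m]≡n i≤m)))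
                (ℕₚ.+-monoˡ-≤ (suc (m ∸ i)) (≤-triangle i))

reverse-C3-≈[] : ∀ m → reverse (m * m) (C3 m) ≈[ suc m ] eulerProduct m ⊛ eulerProduct m
reverse-C3-≈[] m = ≈[]-trans (≈⇒≈[] (suc m) (reverse-C3 m))
  (≈[]-trans (sumS-cong-≈[] (suc m) λ i i≤m → ≈[]-trans
                (≈[]-sym (reversedC3Term-≈[] (ℕₚ.≤-pred i≤m)))
                (≈⇒≈[] (suc m) (≈-sym (eulerProduct-⊛-qBinomialTerm (ℕₚ.≤-pred i≤m)))))
  (≈⇒≈[] (suc m) (≈-sym (≈-trans (⊛-congˡ (eulerProduct m) (q-binomial m))
                                 (⊛-sumS (eulerProduct m) (qBinomialTerm m) (suc m))))))

C3-top-coefficient : ∀ {m h} → h ≤ m → C3 m (m * m ∸ h) ≡ eulerCoeff 3 h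
C3-top-coefficient {m} {h} h≤m = begin
  C3 m (m * m ∸ h)                          ≡⟨ reverse-≤ (≤-square h≤m) ⟨
  reverse (m * m) (C3 m) h                  ≡⟨ at< (reverse-C3-≈[] m) h (s≤s h≤m) ⟩
  (eulerProduct m ⊛ eulerProduct m) h       ≡⟨ at< (≈[]-⊛ P≈P P≈P) h ℕₚ.≤-refl ⟩
  (eulerProduct h ⊛ eulerProduct h) h       ≡⟨ eulerCoeff-3 h ⟨
  eulerCoeff 3 h                            ∎
  where
  open ≡-Reasoning
  P≈P = eulerProduct-truncate h≤m

proposition13 : (m : ℕ) → 1 ≤ m → (k : ℕ) → k ≤ 3 → (C : Series) → IsC m k C →
    (h : ℕ) → h ≤ m → coeff C (m * m ∸ h) ≡ eulerCoeff k h
proposition13 m _ 0 _ C isC h h≤m = C0-top-coefficient {m} {h} {C} isC h≤m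
proposition13 m _ 1 _ C isC h h≤m = trans (isC (m * m ∸ h)) (C1-top-coefficient h≤m)
proposition13 m _ 2 _ C isC h h≤m = trans (isC (m * m ∸ h)) (C2-top-coefficient h≤m)
proposition13 m _ 3 _ C isC h h≤m = trans (isC (m * m ∸ h)) (C3-top-coefficient h≤m)
proposition13 m _ (suc (suc (suc (suc k)))) (s≤s (s≤s (s≤s ()))) C isC h h≤m
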